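{- Let $G$ be a graph with first Betti number $g\geq1$. Then there exist non-cycle inner edges $e_1,\ldots,e_k$ of $G$ such that $G^{e_1,\ldots,e_k}=G_0\sqcup G_1\sqcup\cdots\sqcup G_k$, where $G_0$ is a multiple polygon graph and $G_1,\ldots,G_k$ are trees.
   Context: Graphs are finite, possibly disconnected, with multiple edges and loops allowed. Leaves are degree-one vertices, leaf edges are edges incident to leaves; other vertices/edges are inner. A cycle is a sequence of unrepeated edges connecting a sequence of vertices returning to its start; a cycle edge is an edge on some cycle. Cutting an inner edge $e$ with endpoints $u,w$ replaces $e$ by two leaf edges attached at $u$ and $w$; the result is $G^e$, and $G^{e_1,\ldots,e_k}$ denotes cutting all of $e_1,\ldots,e_k$. The first Betti number is the minimal number of cuts making the graph acyclic. A graph with first Betti number $\ge1$ is a multiple polygon graph if for no edge $e$ can one write $G^e=G'\sqcup G''$ with $G'$ or $G''$ a tree with more than one edge. -}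

module Defs where

open import Data.Nat using (ℕ; zero; suc; _+_; _≤_; _<_)
open import Data.Fin as Fin using (Fin; zero; suc; _↑ˡ_; _↑ʳ_; splitAt)
open import Data.Fin.Properties using () renaming (_≟_ to _≟F_)
open import Data.Product using (Σ; ∃; ∃-syntax; _×_; _,_; proj₁; proj₂; swap)
import Data.Product as P
open import Data.Sum using (_⊎_; inj₁; inj₂)
open import Data.List using (List; []; _∷_; map; allFin; length; foldr)
open import Data.Nat.ListAction using (sum)
open import Data.List.Membership.Propositional using (_∈_)
open import Data.List.Relation.Unary.All using (All)
open import Data.List.Relation.Unary.Unique.Propositional using (Unique)
open import Relation.Binary.PropositionalEquality using (_≡_)
open import Relation.Nullary using (¬_; yes; no)
open import Function.Bundles using (_↔_; Inverse)

-- Vertices are Fin V, edges are Fin E; each edge has an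
-- (arbitrarily oriented) pair of endpoints; a loop has equal endpoints.

record Graph : Set where
  field
    V    : ℕ
    E    : ℕ
    ends : Fin E → Fin V × Fin V
open Graph public

-- degree: number of edge-ends at v (a loop contributes 2)
deg : (G : Graph) → Fin (V G) → ℕ
deg G v = sum (map (λ e → hit (proj₁ (ends G e)) + hit (proj₂ (ends G e))) (allFin (E G)))
  where
  hit : Fin (V G) → ℕ
  hit x with x ≟F v
  ... | yes _ = 1
  ... | no _  = 0

Leaf : (G : Graph) → Fin (V G) → Set
Leaf G v = deg G v ≡ 1

LeafEdge : (G : Graph) → Fin (E G) → Set
LeafEdge G e = Leaf G (proj₁ (ends G e)) ⊎ Leaf G (proj₂ (ends G e))

InnerEdge : (G : Graph) → Fin (E G) → Set
InnerEdge G e = ¬ LeafEdge G e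

Joins : (G : Graph) → Fin (E G) → Fin (V G) → Fin (V G) → Set
Joins G e u w = ends G e ≡ (u , w) ⊎ ends G e ≡ (w , u)

data Walk (G : Graph) : Fin (V G) → Fin (V G) → List (Fin (E G)) → Set where
  nil  : ∀ {v} → Walk G v v []
  step : ∀ {u w x e es} → Joins G e u w → Walk G w x es → Walk G u x (e ∷ es)

IsCycle : (G : Graph) → List (Fin (E G)) → Set
IsCycle G es = (¬ es ≡ []) × Unique es × ∃[ v ] Walk G v v es

CycleEdge : (G : Graph) → Fin (E G) → Set
CycleEdge G e = ∃[ es ] (IsCycle G es × e ∈ es)

Acyclic : Graph → Set
Acyclic G = ∀ es → ¬ IsCycle G es

Connected : Graph → Set
Connected G = (0 < V G) × (∀ u w → ∃[ es ] Walk G u w es)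

Tree : Graph → Set
Tree G = Connected G × Acyclic G

-- Cutting an edge e with endpoints u,w: e is replaced by two leaf edges.
-- New vertices: zero (new leaf attached at u) and suc zero (new leaf
-- attached at w); old vertex v becomes suc (suc v).  Old edge f becomes
-- suc f; the edge suc e now joins u and the new leaf zero, and the new
-- edge zero joins the new leaf suc zero and w.

cut : (G : Graph) → Fin (E G) → Graph
cut G e = record { V = suc (suc (V G)) ; E = suc (E G) ; ends = ends' }
  where
  old : Fin (V G) → Fin (suc (suc (V G)))
  old v = suc (suc v)
  ends' : Fin (suc (E G)) → Fin (suc (suc (V G))) × Fin (suc (suc (V G)))
  ends' zero = (suc zero , old (proj₂ (ends G e)))
  ends' (suc f) with f ≟F e
  ... | yes _ = (old (proj₁ (ends G e)) , zero)
  ... | no _  = (old (proj₁ (ends G f)) , old (proj₂ (ends G f)))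

-- G^{e₁,…,eₖ}: cut the listed edges of G one after another (an edge f of
-- G is referred to as suc f after a cut).
-- (the ℕ argument is only fuel for termination; cutList uses length es)
cutAux : ℕ → (G : Graph) → List (Fin (E G)) → Graph
cutAux zero    G _        = G
cutAux (suc n) G []       = G
cutAux (suc n) G (e ∷ es) = cutAux n (cut G e) (map suc es)

cutList : (G : Graph) → List (Fin (E G)) → Graph
cutList G es = cutAux (length es) G es

Cuts : (G : Graph) → List (Fin (E G)) → Set
Cuts G es = Unique es × All (InnerEdge G) es

IsFirstBetti : Graph → ℕ → Set
IsFirstBetti G g =
  (∃[ es ] (length es ≡ g × Cuts G es × Acyclic (cutList G es)))
  × (∀ es → Cuts G es → Acyclic (cutList G es) → g ≤ length es)

_⊔_ : Graph → Graph → Graph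
G ⊔ H = record { V = V G + V H ; E = E G + E H ; ends = ends' }
  where
  ends' : Fin (E G + E H) → Fin (V G + V H) × Fin (V G + V H)
  ends' i with splitAt (E G) i
  ... | inj₁ e = P.map (_↑ˡ V H) (_↑ˡ V H) (ends G e)
  ... | inj₂ e = P.map (V G ↑ʳ_) (V G ↑ʳ_) (ends H e)

emptyGraph : Graph
emptyGraph = record { V = 0 ; E = 0 ; ends = λ () }

⨆ : List Graph → Graph
⨆ = foldr _⊔_ emptyGraph

record _≅_ (G H : Graph) : Set where
  field
    isoV  : Fin (V G) ↔ Fin (V H)
    isoE  : Fin (E G) ↔ Fin (E H)
    compat : ∀ e → let f = Inverse.to isoV in
             ends H (Inverse.to isoE e) ≡ P.map f f (ends G e)
             ⊎ ends H (Inverse.to isoE e) ≡ swap (P.map f f (ends G e))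
open _≅_ public

-- Multiple polygon graphs.
-- "G^e = G' ⊔ G''" is read as: an isomorphism of G^e with G' ⊔ G'' under
-- which the two new leaves created by the cut lie in different summands
--.

InLeft : ∀ {A B : Graph} → Fin (V A + V B) → Set
InLeft {A} {B} x = ∃[ y ] x ≡ y ↑ˡ V B

InRight : ∀ {A B : Graph} → Fin (V A + V B) → Set
InRight {A} {B} x = ∃[ y ] x ≡ V A ↑ʳ y

SplitsAt : (G : Graph) (e : Fin (E G)) (G' G'' : Graph) → Set
SplitsAt G e G' G'' = Σ (cut G e ≅ (G' ⊔ G'')) λ ι →
  let f = Inverse.to (isoV ι) in
    (InLeft {G'} {G''} (f zero) × InRight {G'} {G''} (f (suc zero)))
  ⊎ (InRight {G'} {G''} (f zero) × InLeft {G'} {G''} (f (suc zero)))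

BigTree : Graph → Set
BigTree T = Tree T × 1 < E T

MultiplePolygon : Graph → Set
MultiplePolygon G =
  (∃[ g ] (IsFirstBetti G g × 1 ≤ g))
  × (∀ e → InnerEdge G e → ∀ G' G'' → SplitsAt G e G' G'' → ¬ (BigTree G' ⊎ BigTree G''))

-- Repeatedly look for an inner edge e of the current core graph whose cut disconnects its two ends
-- and leaves one of the two new leaves in a tree component with more than one edge. Such an e lies
-- on no cycle, so it is the image of a non-cycle inner edge of G that has not been cut yet; cutting
-- it there splits that tree off, keeps a cycle in the rest and strictly lowers the number of edges
-- of the core. When no such edge is left, the core is a multiple polygon graph: a splitting
-- G₀^e = G′ ⊔ G″ separating the new leaves with a big tree on one side would be such an edge.
-- All notions involved are decidable for finite graphs, which makes the search constructive.

module Submission where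

open import Defs
open import Data.Bool using (Bool; true; false; _∨_)
import Data.Bool.Properties as Bool
open import Data.Empty using (⊥-elim)
open import Data.Fin using (Fin; zero; suc; _↑ˡ_; _↑ʳ_; splitAt; join)
open import Data.Fin.Permutation using (↔⇒≡)
open import Data.Fin.Properties
  using (suc-injective; ↑ˡ-injective; ↑ʳ-injective; splitAt-↑ˡ; splitAt-↑ʳ; splitAt⁻¹-↑ˡ; splitAt⁻¹-↑ʳ; join-splitAt; splitAt-join; any?; pigeonhole; injective⇒≤)
  renaming (_≟_ to _≟ᶠ_; <⇒≢ to <⇒≢ᶠ)
open import Data.List using (List; []; _∷_; _++_; map; length; lookup; filter; allFin; tabulate)
open import Data.List.Membership.Propositional using (_∈_)
open import Data.List.Membership.Propositional.Properties using (∈-map⁺; ∈-map⁻; ∈-∃++; ∈-++⁻; ∈-++⁺ˡ; ∈-++⁺ʳ; ∈-lookup; ∈-filter⁺; ∈-allFin)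
open import Data.List.Properties using (map-++; length-map; length-++; map-tabulate)
open import Data.List.Relation.Unary.All using (All; []; _∷_)
import Data.List.Relation.Unary.All as All
import Data.List.Relation.Unary.All.Properties as All
open import Data.List.Relation.Unary.Any using (here; there)
open import Data.List.Relation.Unary.Unique.Propositional using (Unique; []; _∷_)
import Data.List.Relation.Unary.Unique.Propositional.Properties as Unique
import Data.List.Relation.Unary.Unique.DecPropositional as UniqueDec
open import Data.Nat using (ℕ; zero; suc; _+_; _≤_; _<_; s≤s; z≤n; _<?_) renaming (_≟_ to _≟ℕ_)
open import Data.Nat.ListAction using (sum)
open import Data.Nat.Properties
  using (+-comm; +-assoc; +-identityʳ; +-suc; +-0-commutativeMonoid; ≤-refl; ≤-reflexive; ≤-trans; ≤-pred; m≤m+n; m≤n+m; n≤1+n;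
         +-mono-≤; +-monoʳ-≤; +-monoˡ-≤; m≤n⇒m<n∨m≡n; ≮⇒≥; n≮n; n≤0⇒n≡0; <-≤-trans)
open import Data.Product using (Σ-syntax; ∃-syntax; _×_; _,_; proj₁; proj₂; swap)
import Data.Product as P
open import Data.Product.Properties using (≡-dec)
open import Data.Sum using (_⊎_; inj₁; inj₂; [_,_]′)
import Data.Sum as S
open import Data.Unit using (⊤; tt)
open import Function.Bundles using (Inverse; Injection; mk↔ₛ′)
open import Function.Properties.Inverse using (↔⇒↣; ↔-sym)
open import Function.Definitions using (Injective)
open import Relation.Binary.PropositionalEquality
open import Relation.Nullary using (¬_; Dec; yes; no; does)
open import Relation.Nullary.Decidable using (_×-dec_; _⊎-dec_; ¬?; decidable-stable; map′)
import Algebra.Properties.CommutativeMonoid.Sum as MonoidSum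

-- Graph maps and isomorphisms

MapsEnds : ∀ {m n} → (Fin m → Fin n) → Fin m × Fin m → Fin n × Fin n → Set
MapsEnds f p q = q ≡ P.map f f p ⊎ q ≡ swap (P.map f f p)

-- Edges outside D (such as a cut edge) need not be mapped compatibly.
record HomOn (G H : Graph) (D : Fin (E G) → Set) : Set where
  field
    onV : Fin (V G) → Fin (V H)
    onE : Fin (E G) → Fin (E H)
    onE-ends : ∀ e → D e → MapsEnds onV (ends G e) (ends H (onE e))
open HomOn public

Hom : Graph → Graph → Set
Hom G H = HomOn G H (λ _ → ⊤)

map-≢[] : ∀ {X Y : Set} (f : X → Y) {xs} → ¬ xs ≡ [] → ¬ map f xs ≡ []
map-≢[] f {[]} xs≢[] _ = xs≢[] refl
map-≢[] f {_ ∷ _} _ ()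

map-≢[]⁻ : ∀ {X Y : Set} (f : X → Y) {xs} → ¬ map f xs ≡ [] → ¬ xs ≡ []
map-≢[]⁻ f fxs≢[] refl = fxs≢[] refl

module _ {G H : Graph} {D : Fin (E G) → Set} (h : HomOn G H D) where

  Joins-map : ∀ {e u w} → D e → Joins G e u w → Joins H (onE h e) (onV h u) (onV h w)
  Joins-map {e} d j with onE-ends h e d
  Joins-map d (inj₁ refl) | inj₁ c = inj₁ c
  Joins-map d (inj₂ refl) | inj₁ c = inj₂ c
  Joins-map d (inj₁ refl) | inj₂ c = inj₂ c
  Joins-map d (inj₂ refl) | inj₂ c = inj₁ c

  Walk-map : ∀ {u w es} → All D es → Walk G u w es → Walk H (onV h u) (onV h w) (map (onE h) es)
  Walk-map [] nil = nil
  Walk-map (d ∷ ds) (step j w) = step (Joins-map d j) (Walk-map ds w)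

  IsCycle-map : Injective _≡_ _≡_ (onE h) → ∀ {es} → All D es → IsCycle G es → IsCycle H (map (onE h) es)
  IsCycle-map inj ds (es≢[] , u , v , w) = map-≢[] (onE h) es≢[] , Unique.map⁺ inj u , onV h v , Walk-map ds w

Walk-hom : ∀ {G H} (h : Hom G H) {u w es} → Walk G u w es → Walk H (onV h u) (onV h w) (map (onE h) es)
Walk-hom h {es = es} = Walk-map h (All.universal (λ _ → tt) es)

module _ {G H : Graph} (ι : G ≅ H) where

  toV : Fin (V G) → Fin (V H)
  toV = Inverse.to (isoV ι)

  fromV : Fin (V H) → Fin (V G)
  fromV = Inverse.from (isoV ι)

  toE : Fin (E G) → Fin (E H)
  toE = Inverse.to (isoE ι)

  fromE : Fin (E H) → Fin (E G)
  fromE = Inverse.from (isoE ι)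

  from-toV : ∀ x → fromV (toV x) ≡ x
  from-toV x = Inverse.inverseʳ (isoV ι) refl

  to-fromV : ∀ y → toV (fromV y) ≡ y
  to-fromV y = Inverse.inverseˡ (isoV ι) refl

  from-toE : ∀ x → fromE (toE x) ≡ x
  from-toE x = Inverse.inverseʳ (isoE ι) refl

  to-fromE : ∀ y → toE (fromE y) ≡ y
  to-fromE y = Inverse.inverseˡ (isoE ι) refl

  toV-injective : Injective _≡_ _≡_ toV
  toV-injective = Injection.injective (↔⇒↣ (isoV ι))

  toE-injective : Injective _≡_ _≡_ toE
  toE-injective = Injection.injective (↔⇒↣ (isoE ι))

  fromE-injective : Injective _≡_ _≡_ fromE
  fromE-injective = Injection.injective (↔⇒↣ (↔-sym (isoE ι)))

  toHom : Hom G H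
  toHom = record { onV = toV ; onE = toE ; onE-ends = λ e _ → compat ι e }

  fromHom : Hom H G
  fromHom = record { onV = fromV ; onE = fromE ; onE-ends = λ e _ → pull (compat ι (fromE e)) }
    where
    fromV-map : ∀ p → P.map fromV fromV (P.map toV toV p) ≡ p
    fromV-map (a , b) = cong₂ _,_ (from-toV a) (from-toV b)
    pull : ∀ {e} → MapsEnds toV (ends G (fromE e)) (ends H (toE (fromE e))) → MapsEnds fromV (ends H e) (ends G (fromE e))
    pull {e} m rewrite to-fromE e with m
    ... | inj₁ c = inj₁ (sym (trans (cong (P.map fromV fromV) c) (fromV-map _)))
    ... | inj₂ c = inj₂ (sym (trans (cong (λ q → swap (P.map fromV fromV q)) c) (fromV-map _)))

  IsCycle-≅ : ∀ {es} → IsCycle G es → IsCycle H (map toE es)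
  IsCycle-≅ {es} = IsCycle-map toHom toE-injective (All.universal (λ _ → tt) es)

P-map-cong : ∀ {A B : Set} {f g : A → B} → (∀ x → f x ≡ g x) → ∀ p → P.map f f p ≡ P.map g g p
P-map-cong f≗g (a , b) = cong₂ _,_ (f≗g a) (f≗g b)

MapsEnds-∘ : ∀ {k m n} {f : Fin k → Fin m} {g : Fin m → Fin n} {p q r} →
             MapsEnds f p q → MapsEnds g q r → MapsEnds (λ x → g (f x)) p r
MapsEnds-∘ (inj₁ refl) (inj₁ refl) = inj₁ refl
MapsEnds-∘ (inj₁ refl) (inj₂ refl) = inj₂ refl
MapsEnds-∘ (inj₂ refl) (inj₁ refl) = inj₂ refl
MapsEnds-∘ (inj₂ refl) (inj₂ refl) = inj₁ refl

MapsEnds-embed : ∀ {a b c d} {f : Fin a → Fin b} {f′ : Fin c → Fin d} (emb : Fin c → Fin a) (emb′ : Fin d → Fin b) →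
                 (∀ x → f (emb x) ≡ emb′ (f′ x)) → ∀ {p q r s} →
                 p ≡ P.map emb emb r → q ≡ P.map emb′ emb′ s → MapsEnds f′ r s → MapsEnds f p q
MapsEnds-embed _ _ comm {r = r} refl refl (inj₁ refl) = inj₁ (sym (P-map-cong comm r))
MapsEnds-embed _ _ comm {r = r} refl refl (inj₂ refl) = inj₂ (sym (cong swap (P-map-cong comm r)))

mkIso : ∀ {G H} (f : Fin (V G) → Fin (V H)) (f⁻ : Fin (V H) → Fin (V G)) →
        (∀ y → f (f⁻ y) ≡ y) → (∀ x → f⁻ (f x) ≡ x) →
        (g : Fin (E G) → Fin (E H)) (g⁻ : Fin (E H) → Fin (E G)) →
        (∀ y → g (g⁻ y) ≡ y) → (∀ x → g⁻ (g x) ≡ x) →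
        (∀ e → MapsEnds f (ends G e) (ends H (g e))) → G ≅ H
mkIso f f⁻ ff⁻ f⁻f g g⁻ gg⁻ g⁻g c = record { isoV = mk↔ₛ′ f f⁻ ff⁻ f⁻f ; isoE = mk↔ₛ′ g g⁻ gg⁻ g⁻g ; compat = c }

≅-refl : ∀ {G} → G ≅ G
≅-refl = mkIso (λ x → x) (λ x → x) (λ _ → refl) (λ _ → refl) (λ x → x) (λ x → x) (λ _ → refl) (λ _ → refl) (λ _ → inj₁ refl)

≅-trans : ∀ {G H K} → G ≅ H → H ≅ K → G ≅ K
≅-trans ι κ = mkIso (λ x → toV κ (toV ι x)) (λ y → fromV ι (fromV κ y))
  (λ y → trans (cong (toV κ) (to-fromV ι _)) (to-fromV κ y))
  (λ x → trans (cong (fromV ι) (from-toV κ _)) (from-toV ι x))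
  (λ x → toE κ (toE ι x)) (λ y → fromE ι (fromE κ y))
  (λ y → trans (cong (toE κ) (to-fromE ι _)) (to-fromE κ y))
  (λ x → trans (cong (fromE ι) (from-toE κ _)) (from-toE ι x))
  (λ e → MapsEnds-∘ {f = toV ι} {g = toV κ} (compat ι e) (compat κ (toE ι e)))

-- Disjoint unions

LR-disjoint : ∀ {m n} (x : Fin m) (y : Fin n) → ¬ x ↑ˡ n ≡ m ↑ʳ y
LR-disjoint {m} {n} x y eq with trans (sym (splitAt-↑ˡ m x n)) (trans (cong (splitAt m) eq) (splitAt-↑ʳ m n y))
... | ()

data LeftOrRight (m n : ℕ) : Fin (m + n) → Set where
  left  : ∀ x → LeftOrRight m n (x ↑ˡ n)
  right : ∀ y → LeftOrRight m n (m ↑ʳ y)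

leftOrRight : ∀ m n (i : Fin (m + n)) → LeftOrRight m n i
leftOrRight m n i with splitAt m i in eq
... | inj₁ x = subst (LeftOrRight m n) (splitAt⁻¹-↑ˡ eq) (left x)
... | inj₂ y = subst (LeftOrRight m n) (splitAt⁻¹-↑ʳ eq) (right y)

module _ {A B : Graph} where

  ends-↑ˡ : ∀ e → ends (A ⊔ B) (e ↑ˡ E B) ≡ P.map (_↑ˡ V B) (_↑ˡ V B) (ends A e)
  ends-↑ˡ e rewrite splitAt-↑ˡ (E A) e (E B) = refl

  ends-↑ʳ : ∀ e → ends (A ⊔ B) (E A ↑ʳ e) ≡ P.map (V A ↑ʳ_) (V A ↑ʳ_) (ends B e)
  ends-↑ʳ e rewrite splitAt-↑ʳ (E A) (E B) e = refl

  inl : Hom A (A ⊔ B)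
  inl = record { onV = _↑ˡ V B ; onE = _↑ˡ E B ; onE-ends = λ e _ → inj₁ (ends-↑ˡ e) }

  ⊔-MapsEnds : ∀ {K : Graph} {f : Fin (V A + V B) → Fin (V K)} {g : Fin (E A + E B) → Fin (E K)} →
               (∀ e → MapsEnds f (ends (A ⊔ B) (e ↑ˡ E B)) (ends K (g (e ↑ˡ E B)))) →
               (∀ e → MapsEnds f (ends (A ⊔ B) (E A ↑ʳ e)) (ends K (g (E A ↑ʳ e)))) →
               ∀ i → MapsEnds f (ends (A ⊔ B) i) (ends K (g i))
  ⊔-MapsEnds l r i with leftOrRight (E A) (E B) i
  ... | left e = l e
  ... | right e = r e

_⊕_ : ∀ {a b a′ b′} → (Fin a → Fin a′) → (Fin b → Fin b′) → Fin (a + b) → Fin (a′ + b′)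
_⊕_ {a} {b} {a′} {b′} f g i = [ (λ x → f x ↑ˡ b′) , (λ y → a′ ↑ʳ g y) ]′ (splitAt a i)

⊕-↑ˡ : ∀ {a b a′ b′} (f : Fin a → Fin a′) (g : Fin b → Fin b′) x → (f ⊕ g) (x ↑ˡ b) ≡ f x ↑ˡ b′
⊕-↑ˡ {a} {b} f g x rewrite splitAt-↑ˡ a x b = refl

⊕-↑ʳ : ∀ {a b a′ b′} (f : Fin a → Fin a′) (g : Fin b → Fin b′) y → (f ⊕ g) (a ↑ʳ y) ≡ a′ ↑ʳ g y
⊕-↑ʳ {a} {b} f g y rewrite splitAt-↑ʳ a b y = refl

⊕-inverse : ∀ {a b a′ b′} (f : Fin a → Fin a′) (g : Fin b → Fin b′) (f⁻ : Fin a′ → Fin a) (g⁻ : Fin b′ → Fin b) →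
            (∀ x → f⁻ (f x) ≡ x) → (∀ y → g⁻ (g y) ≡ y) → ∀ i → (f⁻ ⊕ g⁻) ((f ⊕ g) i) ≡ i
⊕-inverse {a} {b} f g f⁻ g⁻ f⁻f g⁻g i with leftOrRight a b i
... | left x = trans (cong (f⁻ ⊕ g⁻) (⊕-↑ˡ f g x)) (trans (⊕-↑ˡ f⁻ g⁻ (f x)) (cong (_↑ˡ b) (f⁻f x)))
... | right y = trans (cong (f⁻ ⊕ g⁻) (⊕-↑ʳ f g y)) (trans (⊕-↑ʳ f⁻ g⁻ (g y)) (cong (a ↑ʳ_) (g⁻g y)))

⊔-cong : ∀ {A A′ B B′} → A ≅ A′ → B ≅ B′ → (A ⊔ B) ≅ (A′ ⊔ B′)
⊔-cong {A} {A′} {B} {B′} ι κ = mkIso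
  (toV ι ⊕ toV κ) (fromV ι ⊕ fromV κ) (⊕-inverse _ _ (toV ι) (toV κ) (to-fromV ι) (to-fromV κ)) (⊕-inverse (toV ι) (toV κ) _ _ (from-toV ι) (from-toV κ))
  (toE ι ⊕ toE κ) (fromE ι ⊕ fromE κ) (⊕-inverse _ _ (toE ι) (toE κ) (to-fromE ι) (to-fromE κ)) (⊕-inverse (toE ι) (toE κ) _ _ (from-toE ι) (from-toE κ))
  (⊔-MapsEnds {A} {B} {A′ ⊔ B′} {toV ι ⊕ toV κ} {toE ι ⊕ toE κ}
    (λ e → MapsEnds-embed {f = toV ι ⊕ toV κ} (_↑ˡ V B) (_↑ˡ V B′) (⊕-↑ˡ (toV ι) (toV κ)) (ends-↑ˡ {A} {B} e)
             (trans (cong (ends (A′ ⊔ B′)) (⊕-↑ˡ (toE ι) (toE κ) e)) (ends-↑ˡ {A′} {B′} (toE ι e))) (compat ι e))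
    (λ e → MapsEnds-embed {f = toV ι ⊕ toV κ} (V A ↑ʳ_) (V A′ ↑ʳ_) (⊕-↑ʳ (toV ι) (toV κ)) (ends-↑ʳ {A} {B} e)
             (trans (cong (ends (A′ ⊔ B′)) (⊕-↑ʳ (toE ι) (toE κ) e)) (ends-↑ʳ {A′} {B′} (toE κ e))) (compat κ e)))

swapFin : ∀ a b → Fin (a + b) → Fin (b + a)
swapFin a b i = [ b ↑ʳ_ , _↑ˡ a ]′ (splitAt a i)

swapFin-↑ˡ : ∀ a b x → swapFin a b (x ↑ˡ b) ≡ b ↑ʳ x
swapFin-↑ˡ a b x rewrite splitAt-↑ˡ a x b = refl

swapFin-↑ʳ : ∀ a b y → swapFin a b (a ↑ʳ y) ≡ y ↑ˡ a
swapFin-↑ʳ a b y rewrite splitAt-↑ʳ a b y = refl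

swapFin-involutive : ∀ a b i → swapFin b a (swapFin a b i) ≡ i
swapFin-involutive a b i with leftOrRight a b i
... | left x rewrite swapFin-↑ˡ a b x = swapFin-↑ʳ b a x
... | right y rewrite swapFin-↑ʳ a b y = swapFin-↑ˡ b a y

⊔-comm : ∀ {A B} → (A ⊔ B) ≅ (B ⊔ A)
⊔-comm {A} {B} = mkIso
  (swapFin (V A) (V B)) (swapFin (V B) (V A)) (swapFin-involutive (V B) (V A)) (swapFin-involutive (V A) (V B))
  (swapFin (E A) (E B)) (swapFin (E B) (E A)) (swapFin-involutive (E B) (E A)) (swapFin-involutive (E A) (E B))
  (⊔-MapsEnds {A} {B} {B ⊔ A} {swapFin (V A) (V B)} {swapFin (E A) (E B)}
    (λ e → MapsEnds-embed {f = swapFin (V A) (V B)} {f′ = λ x → x} (_↑ˡ V B) (V B ↑ʳ_) (swapFin-↑ˡ (V A) (V B)) (ends-↑ˡ {A} {B} e)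
             (trans (cong (ends (B ⊔ A)) (swapFin-↑ˡ (E A) (E B) e)) (ends-↑ʳ {B} {A} e)) (inj₁ refl))
    (λ e → MapsEnds-embed {f = swapFin (V A) (V B)} {f′ = λ x → x} (V A ↑ʳ_) (_↑ˡ V A) (swapFin-↑ʳ (V A) (V B)) (ends-↑ʳ {A} {B} e)
             (trans (cong (ends (B ⊔ A)) (swapFin-↑ʳ (E A) (E B) e)) (ends-↑ˡ {B} {A} e)) (inj₁ refl)))

assocFin : ∀ a b c → Fin ((a + b) + c) → Fin (a + (b + c))
assocFin a b c i = [ (λ x → [ _↑ˡ (b + c) , (λ y → a ↑ʳ (y ↑ˡ c)) ]′ (splitAt a x)) , (λ z → a ↑ʳ (b ↑ʳ z)) ]′ (splitAt (a + b) i)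

assocFin⁻ : ∀ a b c → Fin (a + (b + c)) → Fin ((a + b) + c)
assocFin⁻ a b c i = [ (λ x → (x ↑ˡ b) ↑ˡ c) , (λ y → [ (λ z → (a ↑ʳ z) ↑ˡ c) , (a + b) ↑ʳ_ ]′ (splitAt b y)) ]′ (splitAt a i)

module _ (a b c : ℕ) where

  assocFin-1 : ∀ x → assocFin a b c ((x ↑ˡ b) ↑ˡ c) ≡ x ↑ˡ (b + c)
  assocFin-1 x rewrite splitAt-↑ˡ (a + b) (x ↑ˡ b) c | splitAt-↑ˡ a x b = refl

  assocFin-2 : ∀ y → assocFin a b c ((a ↑ʳ y) ↑ˡ c) ≡ a ↑ʳ (y ↑ˡ c)
  assocFin-2 y rewrite splitAt-↑ˡ (a + b) (a ↑ʳ y) c | splitAt-↑ʳ a b y = refl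

  assocFin-3 : ∀ z → assocFin a b c ((a + b) ↑ʳ z) ≡ a ↑ʳ (b ↑ʳ z)
  assocFin-3 z rewrite splitAt-↑ʳ (a + b) c z = refl

  assocFin⁻-1 : ∀ x → assocFin⁻ a b c (x ↑ˡ (b + c)) ≡ (x ↑ˡ b) ↑ˡ c
  assocFin⁻-1 x rewrite splitAt-↑ˡ a x (b + c) = refl

  assocFin⁻-2 : ∀ y → assocFin⁻ a b c (a ↑ʳ (y ↑ˡ c)) ≡ (a ↑ʳ y) ↑ˡ c
  assocFin⁻-2 y rewrite splitAt-↑ʳ a (b + c) (y ↑ˡ c) | splitAt-↑ˡ b y c = refl

  assocFin⁻-3 : ∀ z → assocFin⁻ a b c (a ↑ʳ (b ↑ʳ z)) ≡ (a + b) ↑ʳ z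
  assocFin⁻-3 z rewrite splitAt-↑ʳ a (b + c) (b ↑ʳ z) | splitAt-↑ʳ b c z = refl

  assocFin-assocFin⁻ : ∀ i → assocFin a b c (assocFin⁻ a b c i) ≡ i
  assocFin-assocFin⁻ i with leftOrRight a (b + c) i
  ... | left x rewrite assocFin⁻-1 x = assocFin-1 x
  ... | right j with leftOrRight b c j
  ...   | left y rewrite assocFin⁻-2 y = assocFin-2 y
  ...   | right z rewrite assocFin⁻-3 z = assocFin-3 z

  assocFin⁻-assocFin : ∀ i → assocFin⁻ a b c (assocFin a b c i) ≡ i
  assocFin⁻-assocFin i with leftOrRight (a + b) c i
  ... | right z rewrite assocFin-3 z = assocFin⁻-3 z
  ... | left j with leftOrRight a b j
  ...   | left x rewrite assocFin-1 x = assocFin⁻-1 x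
  ...   | right y rewrite assocFin-2 y = assocFin⁻-2 y

⊔-assoc : ∀ {A B C} → ((A ⊔ B) ⊔ C) ≅ (A ⊔ (B ⊔ C))
⊔-assoc {A} {B} {C} = mkIso
  f (assocFin⁻ (V A) (V B) (V C)) (assocFin-assocFin⁻ (V A) (V B) (V C)) (assocFin⁻-assocFin (V A) (V B) (V C))
  g (assocFin⁻ (E A) (E B) (E C)) (assocFin-assocFin⁻ (E A) (E B) (E C)) (assocFin⁻-assocFin (E A) (E B) (E C))
  compat-assoc
  where
  f = assocFin (V A) (V B) (V C)
  g = assocFin (E A) (E B) (E C)
  compat-assoc : ∀ i → MapsEnds f (ends ((A ⊔ B) ⊔ C) i) (ends (A ⊔ (B ⊔ C)) (g i))
  compat-assoc i with leftOrRight (E A + E B) (E C) i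
  ... | right z = MapsEnds-embed {f = f} {f′ = λ t → t} ((V A + V B) ↑ʳ_) (λ t → V A ↑ʳ (V B ↑ʳ t))
        (assocFin-3 (V A) (V B) (V C)) (ends-↑ʳ {A ⊔ B} {C} z)
        (trans (cong (ends (A ⊔ (B ⊔ C))) (assocFin-3 (E A) (E B) (E C) z))
               (trans (ends-↑ʳ {A} {B ⊔ C} (E B ↑ʳ z)) (cong (P.map (V A ↑ʳ_) (V A ↑ʳ_)) (ends-↑ʳ {B} {C} z))))
        (inj₁ refl)
  ... | left j with leftOrRight (E A) (E B) j
  ...   | left x = MapsEnds-embed {f = f} {f′ = λ t → t} (λ t → (t ↑ˡ V B) ↑ˡ V C) (_↑ˡ (V B + V C))
          (assocFin-1 (V A) (V B) (V C))
          (trans (ends-↑ˡ {A ⊔ B} {C} (x ↑ˡ E B)) (cong (P.map (_↑ˡ V C) (_↑ˡ V C)) (ends-↑ˡ {A} {B} x)))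
          (trans (cong (ends (A ⊔ (B ⊔ C))) (assocFin-1 (E A) (E B) (E C) x)) (ends-↑ˡ {A} {B ⊔ C} x))
          (inj₁ refl)
  ...   | right y = MapsEnds-embed {f = f} {f′ = λ t → t} (λ t → (V A ↑ʳ t) ↑ˡ V C) (λ t → V A ↑ʳ (t ↑ˡ V C))
          (assocFin-2 (V A) (V B) (V C))
          (trans (ends-↑ˡ {A ⊔ B} {C} (E A ↑ʳ y)) (cong (P.map (_↑ˡ V C) (_↑ˡ V C)) (ends-↑ʳ {A} {B} y)))
          (trans (cong (ends (A ⊔ (B ⊔ C))) (assocFin-2 (E A) (E B) (E C) y))
                 (trans (ends-↑ʳ {A} {B ⊔ C} (y ↑ˡ E C)) (cong (P.map (V A ↑ʳ_) (V A ↑ʳ_)) (ends-↑ˡ {B} {C} y))))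
          (inj₁ refl)

⊔-emptyʳ : ∀ {G} → G ≅ (G ⊔ emptyGraph)
⊔-emptyʳ {G} = mkIso (_↑ˡ 0) (dropEmpty (V G)) (↑ˡ-dropEmpty (V G)) (dropEmpty-↑ˡ (V G))
                        (_↑ˡ 0) (dropEmpty (E G)) (↑ˡ-dropEmpty (E G)) (dropEmpty-↑ˡ (E G))
                        (λ e → inj₁ (ends-↑ˡ {G} {emptyGraph} e))
  where
  dropEmpty : ∀ n → Fin (n + 0) → Fin n
  dropEmpty n i = [ (λ x → x) , (λ ()) ]′ (splitAt n i)
  dropEmpty-↑ˡ : ∀ n x → dropEmpty n (x ↑ˡ 0) ≡ x
  dropEmpty-↑ˡ n x = cong [ (λ x → x) , (λ ()) ]′ (splitAt-↑ˡ n x 0)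
  ↑ˡ-dropEmpty : ∀ n i → dropEmpty n i ↑ˡ 0 ≡ i
  ↑ˡ-dropEmpty n i with leftOrRight n 0 i
  ... | left x = cong (_↑ˡ 0) (dropEmpty-↑ˡ n x)

-- Cutting an edge

-- Case split on f ≟ e without abstracting the test f ≟ e occurring inside cut, flipEdge and swapHalves.
≡-or-≢ : ∀ {n} (f e : Fin n) → f ≡ e ⊎ ¬ f ≡ e
≡-or-≢ f e with f ≟ᶠ e
... | yes f≡e = inj₁ f≡e
... | no f≢e = inj₂ f≢e

oldV : ∀ {n} → Fin n → Fin (suc (suc n))
oldV v = suc (suc v)

module _ (G : Graph) (e : Fin (E G)) where

  ends-cut-self : ends (cut G e) (suc e) ≡ (oldV (proj₁ (ends G e)) , zero)
  ends-cut-self with e ≟ᶠ e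
  ... | yes _ = refl
  ... | no e≢e = ⊥-elim (e≢e refl)

  ends-cut-other : ∀ f → ¬ f ≡ e → ends (cut G e) (suc f) ≡ P.map oldV oldV (ends G f)
  ends-cut-other f f≢e with f ≟ᶠ e
  ... | yes f≡e = ⊥-elim (f≢e f≡e)
  ... | no _ = refl

  cut-inclusion : HomOn G (cut G e) (λ f → ¬ f ≡ e)
  cut-inclusion = record { onV = oldV ; onE = suc ; onE-ends = λ f f≢e → inj₁ (ends-cut-other f f≢e) }

  flipEdge : Graph
  flipEdge = record { V = V G ; E = E G ; ends = ends′ }
    where
    ends′ : Fin (E G) → Fin (V G) × Fin (V G)
    ends′ f with f ≟ᶠ e
    ... | yes _ = swap (ends G f)
    ... | no _ = ends G f

  ends-flipEdge-self : ends flipEdge e ≡ swap (ends G e)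
  ends-flipEdge-self with e ≟ᶠ e
  ... | yes _ = refl
  ... | no e≢e = ⊥-elim (e≢e refl)

  ends-flipEdge-other : ∀ f → ¬ f ≡ e → ends flipEdge f ≡ ends G f
  ends-flipEdge-other f f≢e with f ≟ᶠ e
  ... | yes f≡e = ⊥-elim (f≢e f≡e)
  ... | no _ = refl

swapNewLeaves : ∀ {n} → Fin (suc (suc n)) → Fin (suc (suc n))
swapNewLeaves zero = suc zero
swapNewLeaves (suc zero) = zero
swapNewLeaves (suc (suc x)) = suc (suc x)

swapNewLeaves-involutive : ∀ {n} (x : Fin (suc (suc n))) → swapNewLeaves (swapNewLeaves x) ≡ x
swapNewLeaves-involutive zero = refl
swapNewLeaves-involutive (suc zero) = refl
swapNewLeaves-involutive (suc (suc x)) = refl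

-- The two halves of a cut edge e are the edges zero and suc e.
swapHalves : ∀ {n} → Fin n → Fin (suc n) → Fin (suc n)
swapHalves e zero = suc e
swapHalves e (suc f) with f ≟ᶠ e
... | yes _ = zero
... | no _ = suc f

swapHalves-self : ∀ {n} (e : Fin n) → swapHalves e (suc e) ≡ zero
swapHalves-self e with e ≟ᶠ e
... | yes _ = refl
... | no e≢e = ⊥-elim (e≢e refl)

swapHalves-other : ∀ {n} (e f : Fin n) → ¬ f ≡ e → swapHalves e (suc f) ≡ suc f
swapHalves-other e f f≢e with f ≟ᶠ e
... | yes f≡e = ⊥-elim (f≢e f≡e)
... | no _ = refl

swapHalves-involutive : ∀ {n} (e : Fin n) x → swapHalves e (swapHalves e x) ≡ x
swapHalves-involutive e zero = swapHalves-self e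
swapHalves-involutive e (suc f) with f ≟ᶠ e
... | yes refl = refl
... | no f≢e = swapHalves-other e f f≢e

cut-flipEdge : ∀ G e → cut (flipEdge G e) e ≅ cut G e
cut-flipEdge G e = mkIso swapNewLeaves swapNewLeaves swapNewLeaves-involutive swapNewLeaves-involutive
                         (swapHalves e) (swapHalves e) (swapHalves-involutive e) (swapHalves-involutive e) compat-flip
  where
  compat-flip : ∀ f → MapsEnds swapNewLeaves (ends (cut (flipEdge G e) e) f) (ends (cut G e) (swapHalves e f))
  compat-flip zero rewrite ends-cut-self G e | ends-flipEdge-self G e = inj₂ refl
  compat-flip (suc f) with ≡-or-≢ f e
  ... | inj₁ refl rewrite ends-cut-self (flipEdge G e) e | ends-flipEdge-self G e | swapHalves-self e = inj₂ refl
  ... | inj₂ f≢e rewrite swapHalves-other e f f≢e | ends-cut-other (flipEdge G e) e f f≢e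
                     | ends-cut-other G e f f≢e | ends-flipEdge-other G e f f≢e = inj₁ refl

liftV : ∀ {m n} → (Fin m → Fin n) → Fin (suc (suc m)) → Fin (suc (suc n))
liftV f zero = zero
liftV f (suc zero) = suc zero
liftV f (suc (suc x)) = oldV (f x)

liftV-inverse : ∀ {m n} (f : Fin m → Fin n) (f⁻ : Fin n → Fin m) → (∀ x → f⁻ (f x) ≡ x) → ∀ x → liftV f⁻ (liftV f x) ≡ x
liftV-inverse f f⁻ f⁻f zero = refl
liftV-inverse f f⁻ f⁻f (suc zero) = refl
liftV-inverse f f⁻ f⁻f (suc (suc x)) = cong oldV (f⁻f x)

liftE : ∀ {m n} → (Fin m → Fin n) → Fin (suc m) → Fin (suc n)
liftE f zero = zero
liftE f (suc x) = suc (f x)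

liftE-inverse : ∀ {m n} (f : Fin m → Fin n) (f⁻ : Fin n → Fin m) → (∀ x → f⁻ (f x) ≡ x) → ∀ x → liftE f⁻ (liftE f x) ≡ x
liftE-inverse f f⁻ f⁻f zero = refl
liftE-inverse f f⁻ f⁻f (suc x) = cong suc (f⁻f x)

cut-≅-aligned : ∀ {A B} (ι : A ≅ B) e → ends B (toE ι e) ≡ P.map (toV ι) (toV ι) (ends A e) → cut A e ≅ cut B (toE ι e)
cut-≅-aligned {A} {B} ι e aligned = mkIso
  (liftV (toV ι)) (liftV (fromV ι)) (liftV-inverse (fromV ι) (toV ι) (to-fromV ι)) (liftV-inverse (toV ι) (fromV ι) (from-toV ι))
  (liftE (toE ι)) (liftE (fromE ι)) (liftE-inverse (fromE ι) (toE ι) (to-fromE ι)) (liftE-inverse (toE ι) (fromE ι) (from-toE ι))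
  compat-cut
  where
  compat-cut : ∀ f → MapsEnds (liftV (toV ι)) (ends (cut A e) f) (ends (cut B (toE ι e)) (liftE (toE ι) f))
  compat-cut zero rewrite aligned = inj₁ refl
  compat-cut (suc f) with ≡-or-≢ f e
  ... | inj₁ refl rewrite ends-cut-self A e | ends-cut-self B (toE ι e) | aligned = inj₁ refl
  ... | inj₂ f≢e rewrite ends-cut-other A e f f≢e | ends-cut-other B (toE ι e) (toE ι f) (λ q → f≢e (toE-injective ι q))
      with compat ι f
  ...   | inj₁ c rewrite c = inj₁ refl
  ...   | inj₂ c rewrite c = inj₂ refl

≅-flipEdge : ∀ {A B} (ι : A ≅ B) e → ends B (toE ι e) ≡ swap (P.map (toV ι) (toV ι) (ends A e)) → A ≅ flipEdge B (toE ι e)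
≅-flipEdge {A} {B} ι e flipped = mkIso
  (toV ι) (fromV ι) (to-fromV ι) (from-toV ι) (toE ι) (fromE ι) (to-fromE ι) (from-toE ι) compat-flipped
  where
  compat-flipped : ∀ f → MapsEnds (toV ι) (ends A f) (ends (flipEdge B (toE ι e)) (toE ι f))
  compat-flipped f with ≡-or-≢ f e
  ... | inj₁ refl rewrite ends-flipEdge-self B (toE ι e) | flipped = inj₁ refl
  ... | inj₂ f≢e rewrite ends-flipEdge-other B (toE ι e) (toE ι f) (λ q → f≢e (toE-injective ι q)) = compat ι f

cut-≅ : ∀ {A B} (ι : A ≅ B) e → cut A e ≅ cut B (toE ι e)
cut-≅ {A} {B} ι e with compat ι e
... | inj₁ c = cut-≅-aligned ι e c
... | inj₂ c = ≅-trans (cut-≅-aligned (≅-flipEdge ι e c) e (trans (ends-flipEdge-self B _) (cong swap c))) (cut-flipEdge B _)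

cut-⊔ˡ : ∀ {A B} e → cut (A ⊔ B) (e ↑ˡ E B) ≅ (cut A e ⊔ B)
cut-⊔ˡ {A} {B} e = mkIso (λ x → x) (λ x → x) (λ _ → refl) (λ _ → refl) (λ x → x) (λ x → x) (λ _ → refl) (λ _ → refl) compat-cut
  where
  compat-cut : ∀ f → MapsEnds (λ x → x) (ends (cut (A ⊔ B) (e ↑ˡ E B)) f) (ends (cut A e ⊔ B) f)
  compat-cut zero rewrite ends-↑ˡ {A} {B} e = inj₁ (ends-↑ˡ {cut A e} {B} zero)
  compat-cut (suc f) with leftOrRight (E A) (E B) f
  compat-cut (suc f) | left x with ≡-or-≢ x e
  ... | inj₁ refl rewrite ends-cut-self (A ⊔ B) (e ↑ˡ E B) | ends-↑ˡ {A} {B} e =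
        inj₁ (trans (ends-↑ˡ {cut A e} {B} (suc e)) (cong (P.map (_↑ˡ V B) (_↑ˡ V B)) (ends-cut-self A e)))
  ... | inj₂ x≢e rewrite ends-cut-other (A ⊔ B) (e ↑ˡ E B) (x ↑ˡ E B) (λ q → x≢e (↑ˡ-injective (E B) x e q)) | ends-↑ˡ {A} {B} x =
        inj₁ (trans (ends-↑ˡ {cut A e} {B} (suc x)) (cong (P.map (_↑ˡ V B) (_↑ˡ V B)) (ends-cut-other A e x x≢e)))
  compat-cut (suc f) | right y rewrite ends-cut-other (A ⊔ B) (e ↑ˡ E B) (E A ↑ʳ y) (λ q → LR-disjoint e y (sym q)) | ends-↑ʳ {A} {B} y =
        inj₁ (ends-↑ʳ {cut A e} {B} y)

-- Degrees

hits : ∀ {n} → Fin n → Fin n → ℕ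
hits v x with x ≟ᶠ v
... | yes _ = 1
... | no _ = 0

hits-self : ∀ {n} (v : Fin n) → hits v v ≡ 1
hits-self v with v ≟ᶠ v
... | yes _ = refl
... | no v≢v = ⊥-elim (v≢v refl)

hits-other : ∀ {n} (v x : Fin n) → ¬ x ≡ v → hits v x ≡ 0
hits-other v x x≢v with x ≟ᶠ v
... | yes x≡v = ⊥-elim (x≢v x≡v)
... | no _ = refl

hits-injective : ∀ {m n} {f : Fin m → Fin n} → Injective _≡_ _≡_ f → ∀ v x → hits (f v) (f x) ≡ hits v x
hits-injective {f = f} inj v x with x ≟ᶠ v
... | yes refl = hits-self (f v)
... | no x≢v = hits-other (f v) (f x) (λ q → x≢v (inj q))

endsAt : ∀ {n} → Fin n → Fin n × Fin n → ℕ
endsAt v (a , b) = hits v a + hits v b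

endsAt-MapsEnds : ∀ {m n} {f : Fin m → Fin n} → Injective _≡_ _≡_ f → ∀ v {p q} → MapsEnds f p q → endsAt (f v) q ≡ endsAt v p
endsAt-MapsEnds inj v {a , b} (inj₁ refl) = cong₂ _+_ (hits-injective inj v a) (hits-injective inj v b)
endsAt-MapsEnds {f = f} inj v {a , b} (inj₂ refl) =
  trans (+-comm (hits (f v) (f b)) _) (cong₂ _+_ (hits-injective inj v a) (hits-injective inj v b))

incidence : (G : Graph) → Fin (V G) → Fin (E G) → ℕ
incidence G v e = endsAt v (ends G e)

open MonoidSum +-0-commutativeMonoid using (sum-cong-≗; sum-permute) renaming (sum to ∑)

-- The summand of deg is local to its definition, so the type of summand-incidence is left to unification.
mutual
  summand-incidence : ∀ G v e → _ ≡ incidence G v e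
  deg-as-list : ∀ G v → deg G v ≡ sum (map (incidence G v) (allFin (E G)))
  deg-as-list G v = sum-map-cong (summand-incidence G v) (allFin (E G))
    where
    sum-map-cong : ∀ {A : Set} {f g : A → ℕ} → (∀ x → f x ≡ g x) → ∀ xs → sum (map f xs) ≡ sum (map g xs)
    sum-map-cong f≗g [] = refl
    sum-map-cong f≗g (x ∷ xs) = cong₂ _+_ (f≗g x) (sum-map-cong f≗g xs)
  summand-incidence G v e with proj₁ (ends G e) ≟ᶠ v | proj₂ (ends G e) ≟ᶠ v
  ... | yes _ | yes _ = refl
  ... | yes _ | no _ = refl
  ... | no _ | yes _ = refl
  ... | no _ | no _ = refl

deg-∑ : ∀ G v → deg G v ≡ ∑ (incidence G v)
deg-∑ G v = trans (deg-as-list G v) (trans (cong sum (map-tabulate (λ x → x) (incidence G v))) (sum-tabulate (incidence G v)))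
  where
  sum-tabulate : ∀ {n} (f : Fin n → ℕ) → sum (tabulate f) ≡ ∑ f
  sum-tabulate {zero} f = refl
  sum-tabulate {suc n} f = cong (f zero +_) (sum-tabulate (λ x → f (suc x)))

∑-zero : ∀ {n} (f : Fin n → ℕ) → (∀ x → f x ≡ 0) → ∑ f ≡ 0
∑-zero {zero} f f≗0 = refl
∑-zero {suc n} f f≗0 rewrite f≗0 zero = ∑-zero (λ x → f (suc x)) (λ x → f≗0 (suc x))

∑-single : ∀ {n} (f : Fin n → ℕ) e → (∀ x → ¬ x ≡ e → f x ≡ 0) → ∑ f ≡ f e
∑-single {suc n} f zero f≗0 rewrite ∑-zero (λ x → f (suc x)) (λ x → f≗0 (suc x) (λ ())) = +-identityʳ _
∑-single {suc n} f (suc e) f≗0 rewrite f≗0 zero (λ ()) =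
  ∑-single (λ x → f (suc x)) e (λ x x≢e → f≗0 (suc x) (λ q → x≢e (suc-injective q)))

∑-update : ∀ {n} (f g : Fin n → ℕ) e c → (∀ x → ¬ x ≡ e → f x ≡ g x) → f e + c ≡ g e → c + ∑ f ≡ ∑ g
∑-update {suc n} f g zero c f≗g fe+c rewrite sum-cong-≗ {x = λ x → f (suc x)} {y = λ x → g (suc x)} (λ x → f≗g (suc x) (λ ())) =
  trans (sym (+-assoc c (f zero) _)) (cong (_+ ∑ (λ x → g (suc x))) (trans (+-comm c (f zero)) fe+c))
∑-update {suc n} f g (suc e) c f≗g fe+c rewrite f≗g zero (λ ()) =
  trans (sym (+-assoc c (g zero) _)) (trans (cong (_+ ∑ (λ x → f (suc x))) (+-comm c (g zero)))
    (trans (+-assoc (g zero) c _) (cong (g zero +_)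
      (∑-update (λ x → f (suc x)) (λ x → g (suc x)) e c (λ x x≢e → f≗g (suc x) (λ q → x≢e (suc-injective q))) fe+c))))

∑-split : ∀ a b (f : Fin (a + b) → ℕ) → ∑ f ≡ ∑ (λ x → f (x ↑ˡ b)) + ∑ (λ y → f (a ↑ʳ y))
∑-split zero b f = refl
∑-split (suc a) b f = trans (cong (f zero +_) (∑-split a b (λ x → f (suc x)))) (sym (+-assoc (f zero) _ _))

∑-≥-term : ∀ {n} (f : Fin n → ℕ) a → f a ≤ ∑ f
∑-≥-term f zero = m≤m+n (f zero) _
∑-≥-term f (suc a) = ≤-trans (∑-≥-term (λ x → f (suc x)) a) (m≤n+m _ (f zero))

∑-≥-two-terms : ∀ {n} (f : Fin n → ℕ) a b → ¬ a ≡ b → f a + f b ≤ ∑ f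
∑-≥-two-terms f zero zero a≢b = ⊥-elim (a≢b refl)
∑-≥-two-terms f zero (suc b) _ = +-monoʳ-≤ (f zero) (∑-≥-term (λ x → f (suc x)) b)
∑-≥-two-terms f (suc a) zero _ = ≤-trans (≤-reflexive (+-comm (f (suc a)) (f zero))) (+-monoʳ-≤ (f zero) (∑-≥-term (λ x → f (suc x)) a))
∑-≥-two-terms f (suc a) (suc b) a≢b = ≤-trans (∑-≥-two-terms (λ x → f (suc x)) a b (λ q → a≢b (cong suc q))) (m≤n+m _ (f zero))

deg-≅ : ∀ {G H} (ι : G ≅ H) v → deg H (toV ι v) ≡ deg G v
deg-≅ {G} {H} ι v = begin
  deg H (toV ι v)                          ≡⟨ deg-∑ H (toV ι v) ⟩
  ∑ (incidence H (toV ι v))                ≡⟨ sum-permute (incidence H (toV ι v)) (isoE ι) ⟩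
  ∑ (λ e → incidence H (toV ι v) (toE ι e)) ≡⟨ sum-cong-≗ (λ e → endsAt-MapsEnds (toV-injective ι) v (compat ι e)) ⟩
  ∑ (incidence G v)                        ≡⟨ deg-∑ G v ⟨
  deg G v                                  ∎
  where open ≡-Reasoning

deg-⊔ˡ : ∀ {A B} v → deg (A ⊔ B) (v ↑ˡ V B) ≡ deg A v
deg-⊔ˡ {A} {B} v = begin
  deg (A ⊔ B) (v ↑ˡ V B)                                        ≡⟨ deg-∑ (A ⊔ B) _ ⟩
  ∑ (incidence (A ⊔ B) (v ↑ˡ V B))                               ≡⟨ ∑-split (E A) (E B) _ ⟩
  ∑ (λ e → incidence (A ⊔ B) (v ↑ˡ V B) (e ↑ˡ E B)) + ∑ (λ e → incidence (A ⊔ B) (v ↑ˡ V B) (E A ↑ʳ e))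
    ≡⟨ cong₂ _+_ (sum-cong-≗ fromA) (∑-zero _ fromB) ⟩
  ∑ (incidence A v) + 0                                          ≡⟨ +-identityʳ _ ⟩
  ∑ (incidence A v)                                              ≡⟨ deg-∑ A v ⟨
  deg A v                                                        ∎
  where
  open ≡-Reasoning
  fromA : ∀ e → incidence (A ⊔ B) (v ↑ˡ V B) (e ↑ˡ E B) ≡ incidence A v e
  fromA e = endsAt-MapsEnds (λ {x} {y} → ↑ˡ-injective (V B) x y) v (inj₁ (ends-↑ˡ {A} {B} e))
  fromB : ∀ e → incidence (A ⊔ B) (v ↑ˡ V B) (E A ↑ʳ e) ≡ 0
  fromB e rewrite ends-↑ʳ {A} {B} e =
    cong₂ _+_ (hits-other _ _ (λ q → LR-disjoint v _ (sym q))) (hits-other _ _ (λ q → LR-disjoint v _ (sym q)))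

module _ (G : Graph) (e : Fin (E G)) where

  oldV-injective : Injective _≡_ _≡_ (oldV {V G})
  oldV-injective refl = refl

  deg-cut-old : ∀ v → deg (cut G e) (oldV v) ≡ deg G v
  deg-cut-old v = begin
    deg (cut G e) (oldV v)                                                ≡⟨ deg-∑ (cut G e) (oldV v) ⟩
    incidence (cut G e) (oldV v) zero + ∑ (λ f → incidence (cut G e) (oldV v) (suc f)) ≡⟨ cong (_+ ∑ (λ f → incidence (cut G e) (oldV v) (suc f))) half₂ ⟩
    hits v (proj₂ (ends G e)) + ∑ (λ f → incidence (cut G e) (oldV v) (suc f))
      ≡⟨ ∑-update _ _ e _ other half₁ ⟩
    ∑ (incidence G v)                                                     ≡⟨ deg-∑ G v ⟨
    deg G v                                                               ∎
    where
    open ≡-Reasoning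
    half₂ : incidence (cut G e) (oldV v) zero ≡ hits v (proj₂ (ends G e))
    half₂ = cong₂ _+_ (hits-other (oldV v) (suc zero) (λ ())) (hits-injective oldV-injective v (proj₂ (ends G e)))
    other : ∀ f → ¬ f ≡ e → incidence (cut G e) (oldV v) (suc f) ≡ incidence G v f
    other f f≢e = endsAt-MapsEnds oldV-injective v (inj₁ (ends-cut-other G e f f≢e))
    half₁ : incidence (cut G e) (oldV v) (suc e) + hits v (proj₂ (ends G e)) ≡ incidence G v e
    half₁ rewrite ends-cut-self G e =
      cong (_+ hits v (proj₂ (ends G e))) (trans (cong (_+ 0) (hits-injective oldV-injective v (proj₁ (ends G e)))) (+-identityʳ _))

  deg-cut-leaf₀ : deg (cut G e) zero ≡ 1
  deg-cut-leaf₀ = trans (deg-∑ (cut G e) zero) (cong₂ _+_ first (trans (∑-single _ e other) self))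
    where
    leaf₀ : Fin (V (cut G e))
    leaf₀ = zero
    first : incidence (cut G e) zero zero ≡ 0
    first = cong₂ _+_ (hits-other leaf₀ (suc zero) (λ ())) (hits-other leaf₀ (oldV (proj₂ (ends G e))) (λ ()))
    other : ∀ f → ¬ f ≡ e → incidence (cut G e) zero (suc f) ≡ 0
    other f f≢e rewrite ends-cut-other G e f f≢e =
      cong₂ _+_ (hits-other leaf₀ (oldV (proj₁ (ends G f))) (λ ())) (hits-other leaf₀ (oldV (proj₂ (ends G f))) (λ ()))
    self : incidence (cut G e) zero (suc e) ≡ 1
    self rewrite ends-cut-self G e = cong₂ _+_ (hits-other leaf₀ (oldV (proj₁ (ends G e))) (λ ())) (hits-self leaf₀)

  deg-cut-leaf₁ : deg (cut G e) (suc zero) ≡ 1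
  deg-cut-leaf₁ = trans (deg-∑ (cut G e) leaf₁) (cong₂ _+_ first (∑-zero _ rest))
    where
    leaf₁ : Fin (V (cut G e))
    leaf₁ = suc zero
    first : incidence (cut G e) leaf₁ zero ≡ 1
    first = cong₂ _+_ (hits-self leaf₁) (hits-other leaf₁ (oldV (proj₂ (ends G e))) (λ ()))
    rest : ∀ f → incidence (cut G e) leaf₁ (suc f) ≡ 0
    rest f with ≡-or-≢ f e
    ... | inj₁ refl rewrite ends-cut-self G e = cong₂ _+_ (hits-other leaf₁ (oldV (proj₁ (ends G e))) (λ ())) (hits-other leaf₁ zero (λ ()))
    ... | inj₂ f≢e rewrite ends-cut-other G e f f≢e =
          cong₂ _+_ (hits-other leaf₁ (oldV (proj₁ (ends G f))) (λ ())) (hits-other leaf₁ (oldV (proj₂ (ends G f))) (λ ()))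

module _ {G H : Graph} {D : Fin (E G) → Set} (h : HomOn G H D) (deg-onV : ∀ v → deg H (onV h v) ≡ deg G v) where

  LeafEdge-map : ∀ {e} → D e → LeafEdge G e → LeafEdge H (onE h e)
  LeafEdge-map {e} d leaf with onE-ends h e d | leaf
  ... | inj₁ c | inj₁ l = inj₁ (trans (cong (λ p → deg H (proj₁ p)) c) (trans (deg-onV _) l))
  ... | inj₁ c | inj₂ l = inj₂ (trans (cong (λ p → deg H (proj₂ p)) c) (trans (deg-onV _) l))
  ... | inj₂ c | inj₁ l = inj₂ (trans (cong (λ p → deg H (proj₂ p)) c) (trans (deg-onV _) l))
  ... | inj₂ c | inj₂ l = inj₁ (trans (cong (λ p → deg H (proj₁ p)) c) (trans (deg-onV _) l))

  LeafEdge-reflect : ∀ {e} → D e → LeafEdge H (onE h e) → LeafEdge G e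
  LeafEdge-reflect {e} d leaf with onE-ends h e d | leaf
  ... | inj₁ c | inj₁ l = inj₁ (trans (sym (deg-onV _)) (trans (cong (λ p → deg H (proj₁ p)) (sym c)) l))
  ... | inj₁ c | inj₂ l = inj₂ (trans (sym (deg-onV _)) (trans (cong (λ p → deg H (proj₂ p)) (sym c)) l))
  ... | inj₂ c | inj₁ l = inj₂ (trans (sym (deg-onV _)) (trans (cong (λ p → deg H (proj₁ p)) (sym c)) l))
  ... | inj₂ c | inj₂ l = inj₁ (trans (sym (deg-onV _)) (trans (cong (λ p → deg H (proj₂ p)) (sym c)) l))

-- Iterated cuts

-- For f ∈ es, embE n G es f is one of the two halves of f.
embV : ∀ n G (es : List (Fin (E G))) → Fin (V G) → Fin (V (cutAux n G es))
embV zero G es v = v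
embV (suc n) G [] v = v
embV (suc n) G (e ∷ es) v = embV n (cut G e) (map suc es) (oldV v)

embE : ∀ n G (es : List (Fin (E G))) → Fin (E G) → Fin (E (cutAux n G es))
embE zero G es f = f
embE (suc n) G [] f = f
embE (suc n) G (e ∷ es) f = embE n (cut G e) (map suc es) (suc f)

embE-injective : ∀ n G es → Injective _≡_ _≡_ (embE n G es)
embE-injective zero G es eq = eq
embE-injective (suc n) G [] eq = eq
embE-injective (suc n) G (e ∷ es) eq = suc-injective (embE-injective n (cut G e) (map suc es) eq)

deg-embV : ∀ n G es v → deg (cutAux n G es) (embV n G es v) ≡ deg G v
deg-embV zero G es v = refl
deg-embV (suc n) G [] v = refl
deg-embV (suc n) G (e ∷ es) v = trans (deg-embV n (cut G e) (map suc es) (oldV v)) (deg-cut-old G e v)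

∉-map-suc : ∀ {n} {f e : Fin n} {es} → ¬ f ∈ e ∷ es → ¬ suc f ∈ map suc es
∉-map-suc f∉e∷es m with ∈-map⁻ suc m
... | _ , m′ , refl = f∉e∷es (there m′)

ends-embE : ∀ n G es f → ¬ f ∈ es → ends (cutAux n G es) (embE n G es f) ≡ P.map (embV n G es) (embV n G es) (ends G f)
ends-embE zero G es f _ = refl
ends-embE (suc n) G [] f _ = refl
ends-embE (suc n) G (e ∷ es) f f∉ =
  trans (ends-embE n (cut G e) (map suc es) (suc f) (∉-map-suc f∉))
        (cong (P.map (embV n (cut G e) (map suc es)) (embV n (cut G e) (map suc es))) (ends-cut-other G e f (λ q → f∉ (here q))))

embedding : ∀ n G es → HomOn G (cutAux n G es) (λ f → ¬ f ∈ es)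
embedding n G es = record { onV = embV n G es ; onE = embE n G es ; onE-ends = λ f f∉ → inj₁ (ends-embE n G es f f∉) }

embE-or-LeafEdge : ∀ n G (es : List (Fin (E G))) → length es ≤ n → ∀ x →
                   (∃[ f ] (¬ f ∈ es × x ≡ embE n G es f)) ⊎ LeafEdge (cutAux n G es) x
embE-or-LeafEdge zero G [] _ x = inj₁ (x , (λ ()) , refl)
embE-or-LeafEdge (suc n) G [] _ x = inj₁ (x , (λ ()) , refl)
embE-or-LeafEdge (suc n) G (e ∷ es) (s≤s len≤n) x
  with embE-or-LeafEdge n (cut G e) (map suc es) (subst (_≤ n) (sym (length-map suc es)) len≤n) x
... | inj₂ leaf = inj₂ leaf
... | inj₁ (zero , f∉ , refl) =
      inj₂ (inj₁ (trans (cong (λ p → deg K (proj₁ p)) (ends-embE n (cut G e) (map suc es) zero f∉))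
                        (trans (deg-embV n (cut G e) (map suc es) (suc zero)) (deg-cut-leaf₁ G e))))
  where K = cutAux n (cut G e) (map suc es)
... | inj₁ (suc f , f∉ , refl) with ≡-or-≢ f e
...   | inj₁ refl =
        inj₂ (inj₂ (trans (cong (λ p → deg K (proj₂ p))
                                (trans (ends-embE n (cut G e) (map suc es) (suc e) f∉)
                                       (cong (P.map (embV n (cut G e) (map suc es)) (embV n (cut G e) (map suc es))) (ends-cut-self G e))))
                          (trans (deg-embV n (cut G e) (map suc es) zero) (deg-cut-leaf₀ G e))))
  where K = cutAux n (cut G e) (map suc es)
...   | inj₂ f≢e = inj₁ (f , f∉e∷es , refl)
  where
  f∉e∷es : ¬ f ∈ e ∷ es
  f∉e∷es (here f≡e) = f≢e f≡e
  f∉e∷es (there m) = f∉ (∈-map⁺ suc m)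

LeafEdge-embE : ∀ n G es f → ¬ f ∈ es → LeafEdge G f → LeafEdge (cutAux n G es) (embE n G es f)
LeafEdge-embE n G es f = LeafEdge-map (embedding n G es) (deg-embV n G es)

cutAux-∷ʳ : ∀ n G (es : List (Fin (E G))) f → length es ≤ n → cutAux (suc n) G (es ++ f ∷ []) ≡ cut (cutAux n G es) (embE n G es f)
cutAux-∷ʳ zero G [] f _ = refl
cutAux-∷ʳ (suc n) G [] f _ = refl
cutAux-∷ʳ (suc n) G (e ∷ es) f (s≤s len≤n) =
  trans (cong (cutAux (suc n) (cut G e)) (map-++ suc es (f ∷ [])))
        (cutAux-∷ʳ n (cut G e) (map suc es) (suc f) (subst (_≤ n) (sym (length-map suc es)) len≤n))

length-∷ʳ : ∀ {A : Set} (xs : List A) x → length (xs ++ x ∷ []) ≡ suc (length xs)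
length-∷ʳ xs x = trans (length-++ xs) (+-comm (length xs) 1)

cutList-∷ʳ : ∀ G (es : List (Fin (E G))) f → cutList G (es ++ f ∷ []) ≡ cut (cutList G es) (embE (length es) G es f)
cutList-∷ʳ G es f = trans (cong (λ k → cutAux k G (es ++ f ∷ [])) (length-∷ʳ es f)) (cutAux-∷ʳ (length es) G es f ≤-refl)

-- Walks and reachability

Reach : (G : Graph) → Fin (V G) → Fin (V G) → Set
Reach G u w = ∃[ es ] Walk G u w es

module _ {G : Graph} where

  Joins-sym : ∀ {e u w} → Joins G e u w → Joins G e w u
  Joins-sym (inj₁ eq) = inj₂ eq
  Joins-sym (inj₂ eq) = inj₁ eq

  _++ʷ_ : ∀ {u v w es fs} → Walk G u v es → Walk G v w fs → Walk G u w (es ++ fs)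
  nil ++ʷ q = q
  step j p ++ʷ q = step j (p ++ʷ q)

  Walk-++⁻ : ∀ {u w} xs {ys} → Walk G u w (xs ++ ys) → ∃[ m ] (Walk G u m xs × Walk G m w ys)
  Walk-++⁻ [] p = _ , nil , p
  Walk-++⁻ (x ∷ xs) (step j p) with Walk-++⁻ xs p
  ... | m , p₁ , p₂ = m , step j p₁ , p₂

  Reach-refl : ∀ {u} → Reach G u u
  Reach-refl = [] , nil

  Reach-trans : ∀ {u v w} → Reach G u v → Reach G v w → Reach G u w
  Reach-trans (_ , p) (_ , q) = _ , p ++ʷ q

  Reach-edge : ∀ {e u w} → Joins G e u w → Reach G u w
  Reach-edge j = _ , step j nil

  Reach-sym : ∀ {u w} → Reach G u w → Reach G w u
  Reach-sym (_ , nil) = Reach-refl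
  Reach-sym (_ , step j p) = Reach-trans (Reach-sym (_ , p)) (Reach-edge (Joins-sym j))

  Walk-last : ∀ {u w} zs → Walk G u w zs → ¬ zs ≡ [] → ∃[ z ] ∃[ c ] (z ∈ zs × Joins G z c w)
  Walk-last [] nil zs≢[] = ⊥-elim (zs≢[] refl)
  Walk-last (z ∷ []) (step j nil) _ = z , _ , here refl , j
  Walk-last (z ∷ z′ ∷ zs) (step _ p) _ with Walk-last (z′ ∷ zs) p (λ ())
  ... | y , c , m , j = y , c , there m , j

Reach-hom : ∀ {G H} (h : Hom G H) {u w} → Reach G u w → Reach H (onV h u) (onV h w)
Reach-hom h (_ , p) = _ , Walk-hom h p

Unique-middle : ∀ {A : Set} (xs : List A) {x ys} → Unique (xs ++ x ∷ ys) → ¬ x ∈ xs ++ ys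
Unique-middle [] (x∉ys ∷ _) = All.All¬⇒¬Any x∉ys
Unique-middle (z ∷ xs) (z∉ ∷ u) (here refl) = All.All¬⇒¬Any z∉ (∈-++⁺ʳ xs (here refl))
Unique-middle (z ∷ xs) (_ ∷ u) (there m) = Unique-middle xs u m

cycle-detour : ∀ {G x} → CycleEdge G x → ∃[ a ] ∃[ b ] ∃[ rs ] (Joins G x a b × Walk G b a rs × ¬ x ∈ rs)
cycle-detour {G} {x} (es , (_ , u , _ , p) , x∈es) with ∈-∃++ x∈es
... | xs , ys , refl with Walk-++⁻ xs p
... | a , p₁ , step {w = b} j p₂ = a , b , ys ++ xs , j , p₂ ++ʷ p₁ , λ m → Unique-middle xs u (swap-++ m)
  where
  swap-++ : x ∈ ys ++ xs → x ∈ xs ++ ys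
  swap-++ m with ∈-++⁻ ys m
  ... | inj₁ m′ = ∈-++⁺ʳ xs m′
  ... | inj₂ m′ = ∈-++⁺ˡ m′

incidence-Joins : ∀ {G e u w} → Joins G e u w → 1 ≤ incidence G u e
incidence-Joins {G} {e} {u} {w} (inj₁ eq) rewrite eq | hits-self u = s≤s z≤n
incidence-Joins {G} {e} {u} {w} (inj₂ eq) rewrite eq | hits-self u = m≤n+m 1 (hits u w)

incidence-loop : ∀ {G e u} → Joins G e u u → 2 ≤ incidence G u e
incidence-loop {G} {e} {u} (inj₁ eq) rewrite eq | hits-self u = ≤-refl
incidence-loop {G} {e} {u} (inj₂ eq) rewrite eq | hits-self u = ≤-refl

deg≥2-two-edges : ∀ {G x y u a b} → ¬ x ≡ y → Joins G x u a → Joins G y u b → 2 ≤ deg G u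
deg≥2-two-edges {G} {x} {y} {u} x≢y j₁ j₂ rewrite deg-∑ G u =
  ≤-trans (+-mono-≤ (incidence-Joins {G} j₁) (incidence-Joins {G} j₂)) (∑-≥-two-terms (incidence G u) x y x≢y)

deg≥2-loop : ∀ {G x u} → Joins G x u u → 2 ≤ deg G u
deg≥2-loop {G} {x} {u} j rewrite deg-∑ G u = ≤-trans (incidence-loop {G} j) (∑-≥-term (incidence G u) x)

CycleEdge-ends-deg≥2 : ∀ {G x} → CycleEdge G x → ∃[ a ] ∃[ b ] (Joins G x a b × 2 ≤ deg G a × 2 ≤ deg G b)
CycleEdge-ends-deg≥2 {G} c with cycle-detour {G} c
... | a , _ , [] , j , nil , _ = a , a , j , deg≥2-loop {G} j , deg≥2-loop {G} j
... | a , b , r ∷ rs , j , step j₂ p , x∉ with Walk-last (r ∷ rs) (step j₂ p) (λ ())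
...   | z , _ , z∈ , j₃ = a , b , j , deg≥2-two-edges {G} (λ q → x∉ (subst (_∈ r ∷ rs) (sym q) z∈)) j (Joins-sym {G} j₃)
                                     , deg≥2-two-edges {G} (λ q → x∉ (here q)) (Joins-sym {G} j) j₂

CycleEdge⇒InnerEdge : ∀ {G x} → CycleEdge G x → InnerEdge G x
CycleEdge⇒InnerEdge {G} {x} c leaf with CycleEdge-ends-deg≥2 {G} c
... | a , b , j , 2≤a , 2≤b = not-leaf j leaf
  where
  not-leaf-at : ∀ {u} → 2 ≤ deg G u → ¬ Leaf G u
  not-leaf-at 2≤u leaf-u with subst (2 ≤_) leaf-u 2≤u
  ... | s≤s ()
  not-leaf : Joins G x a b → ¬ LeafEdge G x
  not-leaf (inj₁ eq) (inj₁ l) = not-leaf-at 2≤a (subst (Leaf G) (cong proj₁ eq) l)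
  not-leaf (inj₁ eq) (inj₂ l) = not-leaf-at 2≤b (subst (Leaf G) (cong proj₂ eq) l)
  not-leaf (inj₂ eq) (inj₁ l) = not-leaf-at 2≤b (subst (Leaf G) (cong proj₁ eq) l)
  not-leaf (inj₂ eq) (inj₂ l) = not-leaf-at 2≤a (subst (Leaf G) (cong proj₂ eq) l)

-- After cutting a cycle edge, its two new leaves are joined through the rest of the cycle.
CycleEdge⇒cut-Reach : ∀ H e → CycleEdge H e → Reach (cut H e) zero (suc zero)
CycleEdge⇒cut-Reach H e c with cycle-detour {H} c
... | a , b , rs , j , p , e∉rs = around j
  where
  K = cut H e
  leaf₁-edge : Reach K (suc zero) (oldV (proj₂ (ends H e)))
  leaf₁-edge = Reach-edge {K} {zero} (inj₁ refl)
  leaf₀-edge : Reach K (oldV (proj₁ (ends H e))) zero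
  leaf₀-edge = Reach-edge {K} {suc e} (inj₁ (ends-cut-self H e))
  detour : Reach K (oldV b) (oldV a)
  detour = _ , Walk-map (cut-inclusion H e) (All.map (λ ne eq → ne (sym eq)) (All.¬Any⇒All¬ rs e∉rs)) p
  around : Joins H e a b → Reach K zero (suc zero)
  around (inj₁ refl) = Reach-sym (Reach-trans leaf₁-edge (Reach-trans detour leaf₀-edge))
  around (inj₂ refl) = Reach-trans (Reach-sym leaf₀-edge) (Reach-trans detour (Reach-sym leaf₁-edge))

-- Decidability and the first Betti number

Leaf? : ∀ G v → Dec (Leaf G v)
Leaf? G v = deg G v ≟ℕ 1

LeafEdge? : ∀ G e → Dec (LeafEdge G e)
LeafEdge? G e = Leaf? G _ ⊎-dec Leaf? G _

InnerEdge? : ∀ G e → Dec (InnerEdge G e)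
InnerEdge? G e = ¬? (LeafEdge? G e)

Joins? : ∀ G e u w → Dec (Joins G e u w)
Joins? G e u w = ≡-dec _≟ᶠ_ _≟ᶠ_ (ends G e) (u , w) ⊎-dec ≡-dec _≟ᶠ_ _≟ᶠ_ (ends G e) (w , u)

Walk? : ∀ G u w es → Dec (Walk G u w es)
Walk? G u w [] with u ≟ᶠ w
... | yes refl = yes nil
... | no u≢w = no λ { nil → u≢w refl }
Walk? G u w (e ∷ es) with any? (λ v → Joins? G e u v ×-dec Walk? G v w es)
... | yes (_ , j , p) = yes (step j p)
... | no ¬p = no λ { (step j p) → ¬p (_ , j , p) }

IsCycle? : ∀ G es → Dec (IsCycle G es)
IsCycle? G es = ¬? (decEmpty es) ×-dec (UniqueDec.unique? _≟ᶠ_ es ×-dec any? (λ v → Walk? G v v es))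
  where
  decEmpty : (xs : List (Fin (E G))) → Dec (xs ≡ [])
  decEmpty [] = yes refl
  decEmpty (_ ∷ _) = no (λ ())

Unique⇒length≤ : ∀ {n} (xs : List (Fin n)) → Unique xs → length xs ≤ n
Unique⇒length≤ {n} xs u = ≮⇒≥ λ n<len → let (i , j , i<j , eq) = pigeonhole n<len (lookup xs) in <⇒≢ᶠ i<j (lookup-injective xs u eq)
  where
  lookup-injective : ∀ (xs : List (Fin n)) → Unique xs → ∀ {i j} → lookup xs i ≡ lookup xs j → i ≡ j
  lookup-injective (x ∷ xs) u {zero} {zero} eq = refl
  lookup-injective (x ∷ xs) (x∉ ∷ u) {zero} {suc j} eq = ⊥-elim (All.All¬⇒¬Any x∉ (subst (_∈ xs) (sym eq) (∈-lookup j)))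
  lookup-injective (x ∷ xs) (x∉ ∷ u) {suc i} {zero} eq = ⊥-elim (All.All¬⇒¬Any x∉ (subst (_∈ xs) eq (∈-lookup i)))
  lookup-injective (x ∷ xs) (x∉ ∷ u) {suc i} {suc j} eq = cong suc (lookup-injective xs u eq)

∃-length? : ∀ {n} k (P : List (Fin n) → Set) → (∀ xs → Dec (P xs)) → Dec (∃[ xs ] (length xs ≡ k × P xs))
∃-length? zero P P? with P? []
... | yes p = yes ([] , refl , p)
... | no ¬p = no λ { ([] , _ , p) → ¬p p }
∃-length? (suc k) P P? with any? (λ x → ∃-length? k (λ xs → P (x ∷ xs)) (λ xs → P? (x ∷ xs)))
... | yes (x , xs , len , p) = yes (x ∷ xs , cong suc len , p)
... | no ¬p = no λ { (x ∷ xs , len , p) → ¬p (x , xs , Data.Nat.Properties.suc-injective len , p) }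

∃-length≤? : ∀ {n} k (P : List (Fin n) → Set) → (∀ xs → Dec (P xs)) → Dec (∃[ xs ] (length xs ≤ k × P xs))
∃-length≤? zero P P? with ∃-length? zero P P?
... | yes (xs , len , p) = yes (xs , ≤-reflexive len , p)
... | no ¬p = no λ (xs , len , p) → ¬p (xs , n≤0⇒n≡0 len , p)
∃-length≤? (suc k) P P? with ∃-length? (suc k) P P? | ∃-length≤? k P P?
... | yes (xs , len , p) | _ = yes (xs , ≤-reflexive len , p)
... | no _ | yes (xs , len , p) = yes (xs , ≤-trans len (n≤1+n k) , p)
... | no ¬p | no ¬q = no λ (xs , len , p) → [ (λ lt → ¬q (xs , ≤-pred lt , p)) , (λ eq → ¬p (xs , eq , p)) ]′ (m≤n⇒m<n∨m≡n len)

HasCycle : Graph → Set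
HasCycle G = ∃[ es ] IsCycle G es

-- A cycle has no repeated edges, so it suffices to search cycles of length at most E G.
acyclic-or-cycle : ∀ G → Acyclic G ⊎ HasCycle G
acyclic-or-cycle G with ∃-length≤? (E G) (IsCycle G) (IsCycle? G)
... | yes (es , _ , c) = inj₂ (es , c)
... | no ¬c = inj₁ (λ es c → ¬c (es , Unique⇒length≤ es (proj₁ (proj₂ c)) , c))

Acyclic? : ∀ G → Dec (Acyclic G)
Acyclic? G = [ yes , (λ (es , c) → no (λ ac → ac es c)) ]′ (acyclic-or-cycle G)

least-witness : (Q : ℕ → Set) → (∀ k → Dec (Q k)) → ∀ m → Q m → ∃[ k ] (Q k × (∀ j → Q j → k ≤ j))
least-witness Q Q? m q with search (suc m)
  where
  search : ∀ n → (∀ j → j < n → ¬ Q j) ⊎ (∃[ k ] (Q k × (∀ j → j < k → ¬ Q j)))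
  search zero = inj₁ (λ j ())
  search (suc n) with search n
  ... | inj₂ found = inj₂ found
  ... | inj₁ none with Q? n
  ...   | yes q = inj₂ (n , q , none)
  ...   | no ¬q = inj₁ (λ j j<1+n → [ none j , (λ { refl → ¬q }) ]′ (m≤n⇒m<n∨m≡n (≤-pred j<1+n)))
... | inj₁ none = ⊥-elim (none m ≤-refl q)
... | inj₂ (k , qk , below) = k , qk , (λ j qj → ≮⇒≥ (λ j<k → below j j<k qj))

AcyclicCutsOfLength : Graph → ℕ → Set
AcyclicCutsOfLength H k = ∃[ es ] (length es ≡ k × Cuts H es × Acyclic (cutList H es))

innerEdges : (H : Graph) → List (Fin (E H))
innerEdges H = filter (InnerEdge? H) (allFin (E H))

innerEdges-Cuts : ∀ H → Cuts H (innerEdges H)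
innerEdges-Cuts H = Unique.filter⁺ (InnerEdge? H) (Unique.allFin⁺ (E H)) , All.all-filter (InnerEdge? H) (allFin (E H))

-- Cutting every inner edge leaves only leaf edges, which lie on no cycle.
innerEdges-Acyclic : ∀ H → Acyclic (cutList H (innerEdges H))
innerEdges-Acyclic H [] (x≢[] , _) = x≢[] refl
innerEdges-Acyclic H (x ∷ es) c with embE-or-LeafEdge (length S) H S ≤-refl x
  where S = innerEdges H
... | inj₂ leaf = CycleEdge⇒InnerEdge (x ∷ es , c , here refl) leaf
... | inj₁ (f , f∉ , refl) = CycleEdge⇒InnerEdge (_ ∷ es , c , here refl)
      (LeafEdge-embE (length (innerEdges H)) H (innerEdges H) f f∉
        (decidable-stable (LeafEdge? H f) (λ inner → f∉ (∈-filter⁺ (InnerEdge? H) (∈-allFin f) inner))))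

firstBetti-exists : ∀ H → HasCycle H → ∃[ g ] (IsFirstBetti H g × 1 ≤ g)
firstBetti-exists H (cs , c)
  with least-witness (AcyclicCutsOfLength H) acyclicCuts? (length (innerEdges H))
         (innerEdges H , refl , innerEdges-Cuts H , innerEdges-Acyclic H)
  where
  acyclicCuts? : ∀ k → Dec (AcyclicCutsOfLength H k)
  acyclicCuts? k = ∃-length? k (λ es → Cuts H es × Acyclic (cutList H es))
                     (λ es → (UniqueDec.unique? _≟ᶠ_ es ×-dec All.all? (InnerEdge? H) es) ×-dec Acyclic? (cutList H es))
... | zero , ([] , _ , _ , ac) , _ = ⊥-elim (ac cs c)
... | suc k , cuts , minimal = suc k , (cuts , (λ es cu ac → minimal (length es) (es , refl , cu , ac))) , s≤s z≤n

-- Connected components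

indicator : Bool → ℕ
indicator true = 1
indicator false = 0

count : ∀ {n} → (Fin n → Bool) → ℕ
count S = ∑ (λ v → indicator (S v))

count≤ : ∀ {n} (S : Fin n → Bool) → count S ≤ n
count≤ {zero} S = z≤n
count≤ {suc n} S with S zero
... | true = s≤s (count≤ (λ v → S (suc v)))
... | false = ≤-trans (count≤ (λ v → S (suc v))) (n≤1+n n)

indicator-mono : ∀ {x y} → (x ≡ true → y ≡ true) → indicator x ≤ indicator y
indicator-mono {true} x⇒y rewrite x⇒y refl = ≤-refl
indicator-mono {false} _ = z≤n

count-< : ∀ {n} (S T : Fin n → Bool) → (∀ v → S v ≡ true → T v ≡ true) → ∀ w → S w ≡ false → T w ≡ true → count S < count T
count-< S T S⊆T zero Sw Tw rewrite Sw | Tw = s≤s (∑-mono (λ v → indicator-mono (S⊆T (suc v))))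
  where
  ∑-mono : ∀ {n} {f g : Fin n → ℕ} → (∀ x → f x ≤ g x) → ∑ f ≤ ∑ g
  ∑-mono {zero} f≤g = z≤n
  ∑-mono {suc n} f≤g = +-mono-≤ (f≤g zero) (∑-mono (λ x → f≤g (suc x)))
count-< S T S⊆T (suc w) Sw Tw =
  ≤-trans (≤-reflexive (sym (+-suc (indicator (S zero)) _)))
          (+-mono-≤ (indicator-mono (S⊆T zero)) (count-< (λ v → S (suc v)) (λ v → T (suc v)) (λ v → S⊆T (suc v)) w Sw Tw))

-- The vertices reachable from u, computed by saturating {u} under adjacency.
module Reachable (G : Graph) (u : Fin (V G)) where

  src tgt : Fin (E G) → Fin (V G)
  src e = proj₁ (ends G e)
  tgt e = proj₂ (ends G e)

  Closed : (Fin (V G) → Bool) → Set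
  Closed S = ∀ e → S (src e) ≡ S (tgt e)

  AdjacentVia : (Fin (V G) → Bool) → Fin (V G) → Fin (E G) → Set
  AdjacentVia S v e = (S (src e) ≡ true × tgt e ≡ v) ⊎ (S (tgt e) ≡ true × src e ≡ v)

  AdjacentVia? : ∀ S v e → Dec (AdjacentVia S v e)
  AdjacentVia? S v e = ((S (src e) Bool.≟ true) ×-dec (tgt e ≟ᶠ v)) ⊎-dec ((S (tgt e) Bool.≟ true) ×-dec (src e ≟ᶠ v))

  grow : (Fin (V G) → Bool) → Fin (V G) → Bool
  grow S v = S v ∨ does (any? (AdjacentVia? S v))

  grow-⊇ : ∀ S v → S v ≡ true → grow S v ≡ true
  grow-⊇ S v Sv rewrite Sv = refl

  grow-adjacent : ∀ S v e → AdjacentVia S v e → grow S v ≡ true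
  grow-adjacent S v e adj with S v
  ... | true = refl
  ... | false with any? (AdjacentVia? S v)
  ...   | yes _ = refl
  ...   | no ¬adj = ⊥-elim (¬adj (e , adj))

  grow-closed : ∀ S → Closed S → ∀ v → grow S v ≡ S v
  grow-closed S closed v with S v in Sv
  ... | true = refl
  ... | false with any? (AdjacentVia? S v)
  ...   | no _ = refl
  ...   | yes (e , inj₁ (Se , refl)) = trans (sym Se) (trans (closed e) Sv)
  ...   | yes (e , inj₂ (Se , refl)) = trans (sym Se) (trans (sym (closed e)) Sv)

  reached : ℕ → Fin (V G) → Bool
  reached zero v = does (v ≟ᶠ u)
  reached (suc k) = grow (reached k)

  -- Until it is closed, each round reaches a new vertex.
  closed-or-large : ∀ k → Closed (reached k) ⊎ k ≤ count (reached k)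
  closed-or-large zero = inj₂ z≤n
  closed-or-large (suc k) with closed-or-large k
  ... | inj₁ closed = inj₁ (λ e → trans (grow-closed (reached k) closed _) (trans (closed e) (sym (grow-closed (reached k) closed _))))
  ... | inj₂ k≤ with any? (λ e → ¬? (reached k (src e) Bool.≟ reached k (tgt e)))
  ...   | no ¬open = inj₁ (λ e → trans (grow-closed (reached k) closed′ _) (trans (closed′ e) (sym (grow-closed (reached k) closed′ _))))
    where
    closed′ : Closed (reached k)
    closed′ e = decidable-stable (reached k (src e) Bool.≟ reached k (tgt e)) (λ ne → ¬open (e , ne))
  ...   | yes (e , ne) with reached k (src e) in Ss | reached k (tgt e) in St
  ...     | true | true = ⊥-elim (ne refl)
  ...     | false | false = ⊥-elim (ne refl)
  ...     | true | false = inj₂ (≤-trans (s≤s k≤) (count-< (reached k) (reached (suc k)) (grow-⊇ (reached k)) (tgt e) St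
                                                     (grow-adjacent (reached k) (tgt e) e (inj₁ (Ss , refl)))))
  ...     | false | true = inj₂ (≤-trans (s≤s k≤) (count-< (reached k) (reached (suc k)) (grow-⊇ (reached k)) (src e) Ss
                                                     (grow-adjacent (reached k) (src e) e (inj₂ (St , refl)))))

  reached-u : ∀ k → reached k u ≡ true
  reached-u zero with u ≟ᶠ u
  ... | yes _ = refl
  ... | no u≢u = ⊥-elim (u≢u refl)
  reached-u (suc k) = grow-⊇ (reached k) u (reached-u k)

  reached⇒Reach : ∀ k v → reached k v ≡ true → Reach G u v
  reached⇒Reach zero v r with v ≟ᶠ u
  reached⇒Reach zero v r | yes refl = Reach-refl
  reached⇒Reach zero v () | no _
  reached⇒Reach (suc k) v r with reached k v in rv
  ... | true = reached⇒Reach k v rv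
  ... | false with any? (AdjacentVia? (reached k) v)
  ...   | yes (e , inj₁ (re , refl)) = Reach-trans (reached⇒Reach k _ re) (Reach-edge {G} {e} (inj₁ refl))
  ...   | yes (e , inj₂ (re , refl)) = Reach-trans (reached⇒Reach k _ re) (Reach-edge {G} {e} (inj₂ refl))
  reached⇒Reach (suc k) v () | false | no _

  -- Abstract, since unfolding the iterated saturation during type checking is very expensive.
  abstract
    component : Fin (V G) → Bool
    component = reached (suc (V G))

    component-Closed : Closed component
    component-Closed with closed-or-large (suc (V G))
    ... | inj₁ closed = closed
    ... | inj₂ large = ⊥-elim (n≮n (V G) (≤-trans large (count≤ component)))

    component-u : component u ≡ true
    component-u = reached-u (suc (V G))

    component⇒Reach : ∀ v → component v ≡ true → Reach G u v
    component⇒Reach = reached⇒Reach (suc (V G))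

    Reach⇒component : ∀ v → Reach G u v → component v ≡ true
    Reach⇒component v (_ , p) = along p component-u
      where
      along : ∀ {a b es} → Walk G a b es → component a ≡ true → component b ≡ true
      along nil ca = ca
      along (step {e = e} (inj₁ refl) p) ca = along p (trans (sym (component-Closed e)) ca)
      along (step {e = e} (inj₂ refl) p) ca = along p (trans (component-Closed e) ca)

Reach? : ∀ G u v → Dec (Reach G u v)
Reach? G u v = map′ (Reachable.component⇒Reach G u v) (Reachable.Reach⇒component G u v) (Reachable.component G u v Bool.≟ true)

record Partition (n : ℕ) (p : Fin n → Bool) : Set where
  field
    ins outs : ℕ
    φ : Fin n → Fin ins ⊎ Fin outs
    ψ : Fin ins ⊎ Fin outs → Fin n
    φ∘ψ : ∀ s → φ (ψ s) ≡ s
    ψ∘φ : ∀ x → ψ (φ x) ≡ x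
    p-ins : ∀ i → p (ψ (inj₁ i)) ≡ true
    p-outs : ∀ j → p (ψ (inj₂ j)) ≡ false

  φ-true : ∀ x → p x ≡ true → ∃[ i ] φ x ≡ inj₁ i
  φ-true x px with φ x in eq
  ... | inj₁ i = i , refl
  ... | inj₂ j with trans (sym px) (trans (cong p (trans (sym (ψ∘φ x)) (cong ψ eq))) (p-outs j))
  ...   | ()

  φ-false : ∀ x → p x ≡ false → ∃[ j ] φ x ≡ inj₂ j
  φ-false x px with φ x in eq
  ... | inj₂ j = j , refl
  ... | inj₁ i with trans (sym px) (trans (cong p (trans (sym (ψ∘φ x)) (cong ψ eq))) (p-ins i))
  ...   | ()

module _ {n : ℕ} {p : Fin (suc n) → Bool} (P : Partition n (λ x → p (suc x))) where
  open Partition P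

  extend-inside : p zero ≡ true → Partition (suc n) p
  extend-inside p0 = record
    { ins = suc ins ; outs = outs ; φ = φ′ ; ψ = ψ′ ; φ∘ψ = φ∘ψ′ ; ψ∘φ = ψ∘φ′ ; p-ins = p-ins′ ; p-outs = p-outs }
    where
    φ′ : Fin (suc n) → Fin (suc ins) ⊎ Fin outs
    φ′ zero = inj₁ zero
    φ′ (suc x) = S.map suc (λ j → j) (φ x)
    ψ′ : Fin (suc ins) ⊎ Fin outs → Fin (suc n)
    ψ′ (inj₁ zero) = zero
    ψ′ (inj₁ (suc i)) = suc (ψ (inj₁ i))
    ψ′ (inj₂ j) = suc (ψ (inj₂ j))
    φ∘ψ′ : ∀ s → φ′ (ψ′ s) ≡ s
    φ∘ψ′ (inj₁ zero) = refl
    φ∘ψ′ (inj₁ (suc i)) rewrite φ∘ψ (inj₁ i) = refl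
    φ∘ψ′ (inj₂ j) rewrite φ∘ψ (inj₂ j) = refl
    ψ∘φ′ : ∀ x → ψ′ (φ′ x) ≡ x
    ψ∘φ′ zero = refl
    ψ∘φ′ (suc x) with φ x in eq
    ... | inj₁ i = cong suc (trans (cong ψ (sym eq)) (ψ∘φ x))
    ... | inj₂ j = cong suc (trans (cong ψ (sym eq)) (ψ∘φ x))
    p-ins′ : ∀ i → p (ψ′ (inj₁ i)) ≡ true
    p-ins′ zero = p0
    p-ins′ (suc i) = p-ins i

  extend-outside : p zero ≡ false → Partition (suc n) p
  extend-outside p0 = record
    { ins = ins ; outs = suc outs ; φ = φ′ ; ψ = ψ′ ; φ∘ψ = φ∘ψ′ ; ψ∘φ = ψ∘φ′ ; p-ins = p-ins ; p-outs = p-outs′ }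
    where
    φ′ : Fin (suc n) → Fin ins ⊎ Fin (suc outs)
    φ′ zero = inj₂ zero
    φ′ (suc x) = S.map (λ i → i) suc (φ x)
    ψ′ : Fin ins ⊎ Fin (suc outs) → Fin (suc n)
    ψ′ (inj₂ zero) = zero
    ψ′ (inj₂ (suc j)) = suc (ψ (inj₂ j))
    ψ′ (inj₁ i) = suc (ψ (inj₁ i))
    φ∘ψ′ : ∀ s → φ′ (ψ′ s) ≡ s
    φ∘ψ′ (inj₂ zero) = refl
    φ∘ψ′ (inj₂ (suc j)) rewrite φ∘ψ (inj₂ j) = refl
    φ∘ψ′ (inj₁ i) rewrite φ∘ψ (inj₁ i) = refl
    ψ∘φ′ : ∀ x → ψ′ (φ′ x) ≡ x
    ψ∘φ′ zero = refl
    ψ∘φ′ (suc x) with φ x in eq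
    ... | inj₁ i = cong suc (trans (cong ψ (sym eq)) (ψ∘φ x))
    ... | inj₂ j = cong suc (trans (cong ψ (sym eq)) (ψ∘φ x))
    p-outs′ : ∀ j → p (ψ′ (inj₂ j)) ≡ false
    p-outs′ zero = p0
    p-outs′ (suc j) = p-outs j

partition : ∀ n (p : Fin n → Bool) → Partition n p
partition zero p = record
  { ins = 0 ; outs = 0 ; φ = λ () ; ψ = λ { (inj₁ ()) ; (inj₂ ()) } ; φ∘ψ = λ { (inj₁ ()) ; (inj₂ ()) } ; ψ∘φ = λ ()
  ; p-ins = λ () ; p-outs = λ () }
partition (suc n) p with p zero in p0
... | true = extend-inside (partition n (λ x → p (suc x))) p0
... | false = extend-outside (partition n (λ x → p (suc x))) p0

module SplitAlong (K : Graph) (p : Fin (V K) → Bool) (closed : ∀ e → p (proj₁ (ends K e)) ≡ p (proj₂ (ends K e))) where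

  private
    PV : Partition (V K) p
    PV = partition (V K) p
    PE : Partition (E K) (λ e → p (proj₁ (ends K e)))
    PE = partition (E K) (λ e → p (proj₁ (ends K e)))
    module PV = Partition PV
    module PE = Partition PE

    inV : ∀ x → p x ≡ true → Fin PV.ins
    inV x px = proj₁ (PV.φ-true x px)
    outV : ∀ x → p x ≡ false → Fin PV.outs
    outV x px = proj₁ (PV.φ-false x px)

  Inside : Graph
  Inside = record { V = PV.ins ; E = PE.ins ; ends = λ i → let e = PE.ψ (inj₁ i) in
             inV (proj₁ (ends K e)) (PE.p-ins i) , inV (proj₂ (ends K e)) (trans (sym (closed e)) (PE.p-ins i)) }

  Outside : Graph
  Outside = record { V = PV.outs ; E = PE.outs ; ends = λ j → let e = PE.ψ (inj₂ j) in
              outV (proj₁ (ends K e)) (PE.p-outs j) , outV (proj₂ (ends K e)) (trans (sym (closed e)) (PE.p-outs j)) }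

  private
    fV : Fin (V K) → Fin (PV.ins + PV.outs)
    fV x = join PV.ins PV.outs (PV.φ x)
    gV : Fin (PV.ins + PV.outs) → Fin (V K)
    gV y = PV.ψ (splitAt PV.ins y)
    fE : Fin (E K) → Fin (PE.ins + PE.outs)
    fE x = join PE.ins PE.outs (PE.φ x)
    gE : Fin (PE.ins + PE.outs) → Fin (E K)
    gE y = PE.ψ (splitAt PE.ins y)

    fV-inside : ∀ x (px : p x ≡ true) → fV x ≡ inV x px ↑ˡ PV.outs
    fV-inside x px = cong (join PV.ins PV.outs) (proj₂ (PV.φ-true x px))
    fV-outside : ∀ x (px : p x ≡ false) → fV x ≡ PV.ins ↑ʳ outV x px
    fV-outside x px = cong (join PV.ins PV.outs) (proj₂ (PV.φ-false x px))

    Compat : Fin (E K) → Set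
    Compat e = MapsEnds fV (ends K e) (ends (Inside ⊔ Outside) (fE e))

    compat-ψ : ∀ s → Compat (PE.ψ s)
    compat-ψ (inj₁ i) rewrite PE.φ∘ψ (inj₁ i) =
      inj₁ (trans (ends-↑ˡ {Inside} {Outside} i) (sym (cong₂ _,_ (fV-inside _ _) (fV-inside _ _))))
    compat-ψ (inj₂ j) rewrite PE.φ∘ψ (inj₂ j) =
      inj₁ (trans (ends-↑ʳ {Inside} {Outside} j) (sym (cong₂ _,_ (fV-outside _ _) (fV-outside _ _))))

  split : K ≅ (Inside ⊔ Outside)
  split = mkIso fV gV
    (λ y → trans (cong (join PV.ins PV.outs) (PV.φ∘ψ _)) (join-splitAt PV.ins PV.outs y))
    (λ x → trans (cong PV.ψ (splitAt-join PV.ins PV.outs (PV.φ x))) (PV.ψ∘φ x))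
    fE gE
    (λ y → trans (cong (join PE.ins PE.outs) (PE.φ∘ψ _)) (join-splitAt PE.ins PE.outs y))
    (λ x → trans (cong PE.ψ (splitAt-join PE.ins PE.outs (PE.φ x))) (PE.ψ∘φ x))
    (λ e → subst Compat (PE.ψ∘φ e) (compat-ψ (PE.φ e)))

  toV-inside : ∀ x → p x ≡ true → ∃[ c ] toV split x ≡ c ↑ˡ V Outside
  toV-inside x px = inV x px , fV-inside x px

  fromV-inside : ∀ c → p (fromV split (c ↑ˡ V Outside)) ≡ true
  fromV-inside c = trans (cong (λ s → p (PV.ψ s)) (splitAt-↑ˡ PV.ins c PV.outs)) (PV.p-ins c)

module _ {A B : Graph} where

  Joins-⊔ˡ : ∀ {i u w} → Joins (A ⊔ B) i (u ↑ˡ V B) w → ∃[ e ] ∃[ w′ ] (i ≡ e ↑ˡ E B × w ≡ w′ ↑ˡ V B × Joins A e u w′)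
  Joins-⊔ˡ {i} {u} j with leftOrRight (E A) (E B) i
  ... | right e with ends B e | ends-↑ʳ {A} {B} e | j
  ...   | a , b | eq | inj₁ j′ = ⊥-elim (LR-disjoint u a (cong proj₁ (trans (sym j′) eq)))
  ...   | a , b | eq | inj₂ j′ = ⊥-elim (LR-disjoint u b (cong proj₂ (trans (sym j′) eq)))
  Joins-⊔ˡ {i} {u} j | left e with ends A e in ends-e | ends-↑ˡ {A} {B} e | j
  ... | a , b | eq | inj₁ j′ = let q = trans (sym j′) eq in
        e , b , refl , cong proj₂ q , inj₁ (trans ends-e (cong (_, b) (↑ˡ-injective (V B) _ _ (sym (cong proj₁ q)))))
  ... | a , b | eq | inj₂ j′ = let q = trans (sym j′) eq in
        e , a , refl , cong proj₁ q , inj₂ (trans ends-e (cong (a ,_) (↑ˡ-injective (V B) _ _ (sym (cong proj₂ q)))))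

  Joins-⊔ʳ : ∀ {i u w} → Joins (A ⊔ B) i (V A ↑ʳ u) w → ∃[ e ] ∃[ w′ ] (i ≡ E A ↑ʳ e × w ≡ V A ↑ʳ w′ × Joins B e u w′)
  Joins-⊔ʳ {i} {u} j with leftOrRight (E A) (E B) i
  ... | left e with ends A e | ends-↑ˡ {A} {B} e | j
  ...   | a , b | eq | inj₁ j′ = ⊥-elim (LR-disjoint a u (sym (cong proj₁ (trans (sym j′) eq))))
  ...   | a , b | eq | inj₂ j′ = ⊥-elim (LR-disjoint b u (sym (cong proj₂ (trans (sym j′) eq))))
  Joins-⊔ʳ {i} {u} j | right e with ends B e in ends-e | ends-↑ʳ {A} {B} e | j
  ... | a , b | eq | inj₁ j′ = let q = trans (sym j′) eq in
        e , b , refl , cong proj₂ q , inj₁ (trans ends-e (cong (_, b) (↑ʳ-injective (V A) _ _ (sym (cong proj₁ q)))))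
  ... | a , b | eq | inj₂ j′ = let q = trans (sym j′) eq in
        e , a , refl , cong proj₁ q , inj₂ (trans ends-e (cong (a ,_) (↑ʳ-injective (V A) _ _ (sym (cong proj₂ q)))))

  Walk-⊔ˡ : ∀ {u x es} → Walk (A ⊔ B) (u ↑ˡ V B) x es → ∃[ x′ ] ∃[ es′ ] (x ≡ x′ ↑ˡ V B × es ≡ map (_↑ˡ E B) es′ × Walk A u x′ es′)
  Walk-⊔ˡ nil = _ , [] , refl , refl , nil
  Walk-⊔ˡ (step j p) with Joins-⊔ˡ j
  ... | e , _ , refl , refl , j′ with Walk-⊔ˡ p
  ...   | x′ , es′ , refl , refl , p′ = x′ , e ∷ es′ , refl , refl , step j′ p′

  Walk-⊔ʳ : ∀ {u x es} → Walk (A ⊔ B) (V A ↑ʳ u) x es → ∃[ x′ ] ∃[ es′ ] (x ≡ V A ↑ʳ x′ × es ≡ map (E A ↑ʳ_) es′ × Walk B u x′ es′)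
  Walk-⊔ʳ nil = _ , [] , refl , refl , nil
  Walk-⊔ʳ (step j p) with Joins-⊔ʳ j
  ... | e , _ , refl , refl , j′ with Walk-⊔ʳ p
  ...   | x′ , es′ , refl , refl , p′ = x′ , e ∷ es′ , refl , refl , step j′ p′

  Reach-⊔ˡ : ∀ {a y} → Reach (A ⊔ B) (a ↑ˡ V B) y → ∃[ b ] (y ≡ b ↑ˡ V B × Reach A a b)
  Reach-⊔ˡ (_ , p) with Walk-⊔ˡ p
  ... | b , es′ , eq , _ , p′ = b , eq , es′ , p′

  IsCycle-⊔ˡ : ∀ {a es} → Walk (A ⊔ B) (a ↑ˡ V B) (a ↑ˡ V B) es → Unique es → ¬ es ≡ [] →
               ∃[ cs ] (IsCycle A cs × es ≡ map (_↑ˡ E B) cs)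
  IsCycle-⊔ˡ {a} p u es≢[] with Walk-⊔ˡ p
  ... | _ , cs , eq , refl , p′ =
        cs , (map-≢[]⁻ _ es≢[] , Unique.map⁻ u , a , subst (λ t → Walk A a t cs) (sym (↑ˡ-injective (V B) _ _ eq)) p′) , refl

  IsCycle-⊔ʳ : ∀ {b es} → Walk (A ⊔ B) (V A ↑ʳ b) (V A ↑ʳ b) es → Unique es → ¬ es ≡ [] →
               ∃[ cs ] (IsCycle B cs × es ≡ map (E A ↑ʳ_) cs)
  IsCycle-⊔ʳ {b} p u es≢[] with Walk-⊔ʳ p
  ... | _ , cs , eq , refl , p′ =
        cs , (map-≢[]⁻ _ es≢[] , Unique.map⁻ u , b , subst (λ t → Walk B b t cs) (sym (↑ʳ-injective (V A) _ _ eq)) p′) , refl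

  IsCycle-⊔ : ∀ {es} → IsCycle (A ⊔ B) es →
              ∃[ cs ] (IsCycle A cs × es ≡ map (_↑ˡ E B) cs) ⊎ ∃[ cs ] (IsCycle B cs × es ≡ map (E A ↑ʳ_) cs)
  IsCycle-⊔ (es≢[] , u , v , p) with leftOrRight (V A) (V B) v
  ... | left a = inj₁ (IsCycle-⊔ˡ p u es≢[])
  ... | right b = inj₂ (IsCycle-⊔ʳ p u es≢[])

  HasCycle-⊔ : HasCycle (A ⊔ B) → HasCycle A ⊎ HasCycle B
  HasCycle-⊔ (es , c) with IsCycle-⊔ c
  ... | inj₁ (cs , c′ , _) = inj₁ (cs , c′)
  ... | inj₂ (cs , c′ , _) = inj₂ (cs , c′)

  CycleEdge-⊔ˡ : ∀ {es x} → IsCycle (A ⊔ B) es → x ↑ˡ E B ∈ es → CycleEdge A x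
  CycleEdge-⊔ˡ {x = x} c x∈ with IsCycle-⊔ c
  ... | inj₁ (cs , c′ , refl) with ∈-map⁻ (_↑ˡ E B) x∈
  ...   | y , y∈ , eq = cs , c′ , subst (_∈ cs) (sym (↑ˡ-injective (E B) _ _ eq)) y∈
  CycleEdge-⊔ˡ {x = x} c x∈ | inj₂ (cs , _ , refl) with ∈-map⁻ (E A ↑ʳ_) x∈
  ... | y , _ , eq = ⊥-elim (LR-disjoint x y eq)

  LeafEdge-⊔ˡ : ∀ e → LeafEdge (A ⊔ B) (e ↑ˡ E B) → LeafEdge A e
  LeafEdge-⊔ˡ e = LeafEdge-reflect (inl {A} {B}) (deg-⊔ˡ {A} {B}) tt

module Component (K : Graph) (u : Fin (V K)) where
  open Reachable K u using (component; component-Closed; component-u; component⇒Reach)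
  open SplitAlong K component component-Closed public

  u-inside : ∃[ c ] toV split u ≡ c ↑ˡ V Outside
  u-inside = toV-inside u component-u

  Reach-inside : ∀ c → Reach K u (fromV split (c ↑ˡ V Outside))
  Reach-inside c = component⇒Reach _ (fromV-inside c)

  Inside-Connected : Connected Inside
  Inside-Connected = positive (proj₁ u-inside) , connect
    where
    positive : ∀ {n} → Fin n → 0 < n
    positive zero = s≤s z≤n
    positive (suc _) = s≤s z≤n
    connect : ∀ c₁ c₂ → Reach Inside c₁ c₂
    connect c₁ c₂ with Reach-⊔ˡ (subst₂ (Reach (Inside ⊔ Outside)) (to-fromV split _) (to-fromV split _)
                                   (Reach-hom (toHom split) (Reach-trans (Reach-sym (Reach-inside c₁)) (Reach-inside c₂))))
    ... | _ , eq , r = subst (Reach Inside c₁) (sym (↑ˡ-injective (V Outside) _ _ eq)) r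

_∘ʰ_ : ∀ {G H K} → Hom H K → Hom G H → Hom G K
h ∘ʰ g = record { onV = λ v → onV h (onV g v) ; onE = λ e → onE h (onE g e)
                ; onE-ends = λ e _ → MapsEnds-∘ {f = onV g} {g = onV h} (onE-ends g e tt) (onE-ends h _ tt) }

module ComponentInSummand {K A B : Graph} (κ : K ≅ (A ⊔ B)) (u : Fin (V K)) (a : Fin (V A)) (u↦a : toV κ u ≡ a ↑ˡ V B) where
  open Component K u

  ¬Reach-⊔ʳ : ∀ w b → toV κ w ≡ V A ↑ʳ b → ¬ Reach K u w
  ¬Reach-⊔ʳ w b w↦b r with Reach-⊔ˡ (subst₂ (Reach (A ⊔ B)) u↦a w↦b (Reach-hom (toHom κ) r))
  ... | _ , eq , _ = LR-disjoint _ b (sym eq)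

  private
    toA : Hom Inside (A ⊔ B)
    toA = toHom κ ∘ʰ (fromHom split ∘ʰ inl {Inside} {Outside})

    toA-left : ∀ c → ∃[ a′ ] onV toA c ≡ a′ ↑ˡ V B
    toA-left c with Reach-⊔ˡ (subst (λ t → Reach (A ⊔ B) t (onV toA c)) u↦a (Reach-hom (toHom κ) (Reach-inside c)))
    ... | a′ , eq , _ = a′ , eq

    toA-injective : Injective _≡_ _≡_ (onE toA)
    toA-injective eq = ↑ˡ-injective (E Outside) _ _ (fromE-injective split (toE-injective κ eq))

  Inside-Acyclic : Acyclic A → Acyclic Inside
  Inside-Acyclic acyclic cs (cs≢[] , uq , v , p) with toA-left v
  ... | a′ , eq = acyclic _ (proj₁ (proj₂ (IsCycle-⊔ˡ {A} {B} (subst (λ t → Walk (A ⊔ B) t t _) eq (Walk-hom toA p))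
                                                       (Unique.map⁺ toA-injective uq) (map-≢[] (onE toA) cs≢[]))))

  E-≤-Inside : Connected A → E A ≤ E Inside
  E-≤-Inside (_ , connected) = injective⇒≤ {f = λ α → proj₁ (inside-edge α)} injective
    where
    fromA : Hom (A ⊔ B) (Inside ⊔ Outside)
    fromA = toHom split ∘ʰ fromHom κ
    inside-edge : ∀ α → ∃[ ε ] onE fromA (α ↑ˡ E B) ≡ ε ↑ˡ E Outside
    inside-edge α with Reach-⊔ˡ (subst (λ t → Reach (Inside ⊔ Outside) t (onV fromA (proj₁ (ends A α) ↑ˡ V B))) (trans (cong (toV split) (trans (cong (fromV κ) (sym u↦a)) (from-toV κ u))) (proj₂ u-inside))
                          (Reach-hom fromA (Reach-hom (inl {A} {B}) (connected a (proj₁ (ends A α))))))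
    ... | _ , src-inside , _ with Joins-⊔ˡ (subst (λ t → Joins (Inside ⊔ Outside) (onE fromA (α ↑ˡ E B)) t (onV fromA (proj₂ (ends A α) ↑ˡ V B))) src-inside
                                             (Joins-map fromA tt (inj₁ (ends-↑ˡ {A} {B} α))))
    ...   | ε , _ , eq , _ , _ = ε , eq
    injective : Injective _≡_ _≡_ (λ α → proj₁ (inside-edge α))
    injective {α} {β} eq = ↑ˡ-injective (E B) _ _ (fromE-injective κ (toE-injective split
                             (trans (proj₂ (inside-edge α)) (trans (cong (_↑ˡ E Outside) eq) (sym (proj₂ (inside-edge β)))))))

  Inside-BigTree : BigTree A → BigTree Inside
  Inside-BigTree ((connected , acyclic) , 1<E) = (Inside-Connected , Inside-Acyclic acyclic) , <-≤-trans 1<E (E-≤-Inside connected)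

-- Splitting off big trees

ComponentBigTree : (K : Graph) → Fin (V K) → Set
ComponentBigTree K u = BigTree (Component.Inside K u)

ComponentBigTree? : ∀ K u → Dec (ComponentBigTree K u)
ComponentBigTree? K u = map′ (λ (acyclic , big) → (Inside-Connected , acyclic) , big) (λ ((_ , acyclic) , big) → acyclic , big)
                             (Acyclic? Inside ×-dec (1 <? E Inside))
  where open Component K u

-- zero and suc zero are the two new leaves of cut H e.
SplitsOffBigTree : (H : Graph) → Fin (E H) → Set
SplitsOffBigTree H e = InnerEdge H e × ¬ Reach (cut H e) zero (suc zero)
                       × (ComponentBigTree (cut H e) zero ⊎ ComponentBigTree (cut H e) (suc zero))

SplitsOffBigTree? : ∀ H e → Dec (SplitsOffBigTree H e)
SplitsOffBigTree? H e = InnerEdge? H e ×-dec ¬? (Reach? (cut H e) zero (suc zero))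
                        ×-dec (ComponentBigTree? (cut H e) zero ⊎-dec ComponentBigTree? (cut H e) (suc zero))

separated-BigTree : ∀ {K A B} (κ : K ≅ (A ⊔ B)) {x y a b} → toV κ x ≡ a ↑ˡ V B → toV κ y ≡ V A ↑ʳ b →
                    BigTree A → ¬ Reach K x y × ComponentBigTree K x
separated-BigTree κ {x} {y} {a} {b} x↦a y↦b bigTree =
  ¬Reach-⊔ʳ y b y↦b , Inside-BigTree bigTree
  where open ComponentInSummand κ x a x↦a

toV-⊔-comm-ˡ : ∀ {K A B} (κ : K ≅ (A ⊔ B)) {x a} → toV κ x ≡ a ↑ˡ V B → toV (≅-trans κ (⊔-comm {A} {B})) x ≡ V B ↑ʳ a
toV-⊔-comm-ˡ {A = A} {B} κ eq = trans (cong (swapFin (V A) (V B)) eq) (swapFin-↑ˡ (V A) (V B) _)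

toV-⊔-comm-ʳ : ∀ {K A B} (κ : K ≅ (A ⊔ B)) {x b} → toV κ x ≡ V A ↑ʳ b → toV (≅-trans κ (⊔-comm {A} {B})) x ≡ b ↑ˡ V A
toV-⊔-comm-ʳ {A = A} {B} κ eq = trans (cong (swapFin (V A) (V B)) eq) (swapFin-↑ʳ (V A) (V B) _)

no-SplitsOffBigTree⇒MultiplePolygon : ∀ H → HasCycle H → (∀ e → ¬ SplitsOffBigTree H e) → MultiplePolygon H
no-SplitsOffBigTree⇒MultiplePolygon H cycle none = firstBetti-exists H cycle , bigTree-side
  where
  bigTree-side : ∀ e → InnerEdge H e → ∀ G′ G″ → SplitsAt H e G′ G″ → ¬ (BigTree G′ ⊎ BigTree G″)
  bigTree-side e inner G′ G″ (κ , inj₁ ((a , 0↦a) , (b , 1↦b))) (inj₁ big) =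
    let apart , tree = separated-BigTree κ 0↦a 1↦b big in none e (inner , apart , inj₁ tree)
  bigTree-side e inner G′ G″ (κ , inj₁ ((a , 0↦a) , (b , 1↦b))) (inj₂ big) =
    let apart , tree = separated-BigTree (≅-trans κ ⊔-comm) (toV-⊔-comm-ʳ κ 1↦b) (toV-⊔-comm-ˡ κ 0↦a) big
    in none e (inner , (λ r → apart (Reach-sym r)) , inj₂ tree)
  bigTree-side e inner G′ G″ (κ , inj₂ ((b , 0↦b) , (a , 1↦a))) (inj₁ big) =
    let apart , tree = separated-BigTree κ 1↦a 0↦b big in none e (inner , (λ r → apart (Reach-sym r)) , inj₂ tree)
  bigTree-side e inner G′ G″ (κ , inj₂ ((b , 0↦b) , (a , 1↦a))) (inj₂ big) =
    let apart , tree = separated-BigTree (≅-trans κ ⊔-comm) (toV-⊔-comm-ʳ κ 0↦b) (toV-⊔-comm-ˡ κ 1↦a) big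
    in none e (inner , apart , inj₁ tree)

record Decomposition (G : Graph) : Set where
  field
    cuts : List (Fin (E G))
    core : Graph
    trees : List Graph
    cuts-unique : Unique cuts
    cuts-bridges : All (λ e → InnerEdge G e × ¬ CycleEdge G e) cuts
    trees-length : length trees ≡ length cuts
    trees-Tree : All Tree trees
    cutList-≅ : cutList G cuts ≅ (core ⊔ ⨆ trees)
    core-HasCycle : HasCycle core
open Decomposition

trivialDecomposition : ∀ G → HasCycle G → Decomposition G
trivialDecomposition G cycle = record
  { cuts = [] ; core = G ; trees = [] ; cuts-unique = [] ; cuts-bridges = [] ; trees-length = refl
  ; trees-Tree = [] ; cutList-≅ = ⊔-emptyʳ ; core-HasCycle = cycle }

module _ {G H R : Graph} {es : List (Fin (E G))} (θ : cutList G es ≅ (H ⊔ R)) where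

  InnerEdge-pullback : ∀ {e} → InnerEdge H e → ∃[ f ] (¬ f ∈ es × InnerEdge G f × toE θ (embE (length es) G es f) ≡ e ↑ˡ E R)
  InnerEdge-pullback {e} inner with embE-or-LeafEdge (length es) G es ≤-refl (fromE θ (e ↑ˡ E R))
  ... | inj₂ leaf = ⊥-elim (inner (LeafEdge-⊔ˡ e (subst (LeafEdge (H ⊔ R)) (to-fromE θ _) (LeafEdge-map (toHom θ) (deg-≅ θ) tt leaf))))
  ... | inj₁ (f , f∉ , eq) = f , f∉ , inner-f , trans (cong (toE θ) (sym eq)) (to-fromE θ _)
    where
    inner-f : InnerEdge G f
    inner-f leaf = inner (LeafEdge-⊔ˡ e (subst (LeafEdge (H ⊔ R)) (trans (cong (toE θ) (sym eq)) (to-fromE θ _))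
                     (LeafEdge-map (toHom θ) (deg-≅ θ) tt (LeafEdge-embE (length es) G es f f∉ leaf))))

  CycleEdge-pushforward : All (λ f → ¬ CycleEdge G f) es → ∀ {f e} → toE θ (embE (length es) G es f) ≡ e ↑ˡ E R →
                          CycleEdge G f → CycleEdge H e
  CycleEdge-pushforward not-cycle {f} f↦e (cs , c , f∈cs) =
    CycleEdge-⊔ˡ (IsCycle-≅ θ (IsCycle-map (embedding (length es) G es) (embE-injective (length es) G es) cs∉es c))
                 (subst (_∈ _) f↦e (∈-map⁺ (toE θ) (∈-map⁺ (embE (length es) G es) f∈cs)))
    where
    cs∉es : All (λ g → ¬ g ∈ es) cs
    cs∉es = All.tabulate (λ g∈cs g∈es → All.lookup not-cycle g∈es (cs , c , g∈cs))

cut-≅-⊔ : ∀ {X H R C D} (θ : X ≅ (H ⊔ R)) {x e} → toE θ x ≡ e ↑ˡ E R → cut H e ≅ (C ⊔ D) → cut X x ≅ (D ⊔ (C ⊔ R))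
cut-≅-⊔ {R = R} {C} {D} θ {x} x↦e κ =
  ≅-trans (subst (λ y → cut _ x ≅ cut _ y) x↦e (cut-≅ θ x))
  (≅-trans (cut-⊔ˡ _)
  (≅-trans (⊔-cong κ (≅-refl {R}))
  (≅-trans (⊔-cong (⊔-comm {C} {D}) (≅-refl {R})) (⊔-assoc {D} {C} {R}))))

HasCycle-cut-remainder : ∀ {H C D e} → HasCycle H → ¬ CycleEdge H e → cut H e ≅ (C ⊔ D) → Acyclic C → HasCycle D
HasCycle-cut-remainder {H} {e = e} (cs , c) not-cycle κ acyclic
  with HasCycle-⊔ (_ , IsCycle-≅ κ (IsCycle-map (cut-inclusion H e) suc-injective (All.tabulate (λ m eq → not-cycle (cs , c , subst (_∈ cs) eq m))) c))
... | inj₁ (_ , c′) = ⊥-elim (acyclic _ c′)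
... | inj₂ cycle = cycle

E-cut-remainder : ∀ {H C D e} → cut H e ≅ (C ⊔ D) → 1 < E C → E D < E H
E-cut-remainder {D = D} κ 1<E = ≤-pred (≤-trans (+-monoˡ-≤ (E D) 1<E) (≤-reflexive (sym (↔⇒≡ (isoE κ)))))

peel : ∀ {G} (d : Decomposition G) e → SplitsOffBigTree (core d) e → Σ[ d′ ∈ Decomposition G ] E (core d′) < E (core d)
peel {G} d e (inner , apart , bigTree) = [ peelAt zero , peelAt (suc zero) ]′ bigTree
  where
  not-cycle : ¬ CycleEdge (core d) e
  not-cycle c = apart (CycleEdge⇒cut-Reach _ e c)
  peelAt : ∀ x → ComponentBigTree (cut (core d) e) x → Σ[ d′ ∈ Decomposition G ] E (core d′) < E (core d)
  peelAt x ((connected , acyclic) , 1<E) with InnerEdge-pullback (cutList-≅ d) inner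
  ... | f , f∉ , inner-f , f↦e = d′ , E-cut-remainder split 1<E
    where
    open Component (cut (core d) e) x
    d′ : Decomposition G
    d′ = record
      { cuts = cuts d ++ f ∷ []
      ; core = Outside
      ; trees = Inside ∷ trees d
      ; cuts-unique = Unique.++⁺ (cuts-unique d) ([] ∷ []) (λ { (f∈ , here refl) → f∉ f∈ })
      ; cuts-bridges = All.++⁺ (cuts-bridges d)
          ((inner-f , (λ c → not-cycle (CycleEdge-pushforward (cutList-≅ d) (All.map proj₂ (cuts-bridges d)) f↦e c))) ∷ [])
      ; trees-length = trans (cong suc (trees-length d)) (sym (length-∷ʳ (cuts d) f))
      ; trees-Tree = (connected , acyclic) ∷ trees-Tree d
      ; cutList-≅ = subst (_≅ _) (sym (cutList-∷ʳ G (cuts d) f)) (cut-≅-⊔ (cutList-≅ d) f↦e split)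
      ; core-HasCycle = HasCycle-cut-remainder (core-HasCycle d) not-cycle split acyclic
      }

decompose : ∀ {G} n (d : Decomposition G) → E (core d) < n → Σ[ d′ ∈ Decomposition G ] MultiplePolygon (core d′)
decompose (suc n) d E<1+n with any? (SplitsOffBigTree? (core d))
... | no none = d , no-SplitsOffBigTree⇒MultiplePolygon (core d) (core-HasCycle d) (λ e s → none (e , s))
... | yes (e , s) with peel d e s
...   | d′ , smaller = decompose n d′ (≤-trans smaller (≤-pred E<1+n))

lemma2p9 : (G : Graph) (g : ℕ) → IsFirstBetti G g → 1 ≤ g →
    ∃[ es ] ∃[ G₀ ] ∃[ Ts ]
      ( Unique es
      × All (λ e → InnerEdge G e × ¬ CycleEdge G e) es
      × length Ts ≡ length es
      × MultiplePolygon G₀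
      × All Tree Ts
      × cutList G es ≅ (G₀ ⊔ ⨆ Ts))
lemma2p9 G g (_ , minimal) 1≤g with acyclic-or-cycle G
... | inj₁ acyclic = ⊥-elim (n≮n 0 (≤-trans 1≤g (minimal [] ([] , []) acyclic)))
... | inj₂ cycle =
  let d , multiplePolygon = decompose (suc (E G)) (trivialDecomposition G cycle) ≤-refl
  in cuts d , core d , trees d , cuts-unique d , cuts-bridges d , trees-length d , multiplePolygon , trees-Tree d , cutList-≅ d
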